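{- The normal form of the cut-net $\{\mathfrak{P},\textbf{0}\}$ (result of their interaction) is $\{\maltese\}$, hence $\mathfrak{P}$ belongs to $(\mathbb{N}at^{\sigma}\Rightarrow\mathbb{N}at^{\alpha})^{\perp\perp}$ but not to $\mathbb{N}at^{\sigma}\Rightarrow\mathbb{N}at^{\alpha}$; and for every $n\geq 1$ the normal form of the cut-net $\{\mathfrak{P},\textbf{n}\}$ is $\textbf{n}\pmb{ - }\textbf{1}$.
   Context: Natural numbers are represented by designs: $\textbf{0}_\sigma=\{(+,\sigma,\emptyset)\}$, $(\textbf{n+1})_\sigma=(+,\sigma,\{0\})(-,\sigma.0,\{1\})\,\textbf{n}_{\sigma.0.1}$; with $\overline{0}=\epsilon$, $\overline{n+1}=\overline{n}.0.1$. $\mathbb{N}at^\sigma$ (resp. $\mathbb{N}at^\alpha$) is the set of these designs on base $\vdash\sigma$ (resp. $\vdash\alpha$). For principal sets $\mathbb{A}^\alpha,\mathbb{B}^\beta$, $\mathbb{A}^{\alpha}\Rightarrow\mathbb{B}^{\beta}$ is the set of designs $\mathfrak{D}$ on base $\alpha\vdash\beta$, minimal w.r.t. inclusion, such that for all $\mathfrak{A}\in\mathbb{A}^\alpha$ the normal form of the cut-net $\{\mathfrak{D},\mathfrak{A}\}$ belongs to $\mathbb{B}^\beta$. $E^\perp$ is the set of designs whose interaction with every element of $E$ yields $\{\maltese\}$. The predecessor design $\mathfrak{P}$, on base $\sigma\vdash\alpha$, starts with a negative rule on $\sigma$ with ramifications $\emptyset$ (followed by the daimon on $\vdash\alpha$)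 and $\{0\}$ (followed by $\mathfrak{P}_{0}$ on $\vdash\sigma.0,\alpha$). For all $i$, $\mathfrak{P}_{\overline{i}}$ on $\vdash\sigma.\overline{i}.0,\alpha.\overline{i}$ is: the positive action $(+,\sigma.\overline{i}.0,\{1\})$ to $\sigma.\overline{i+1}\vdash\alpha.\overline{i}$, then a negative rule on $\sigma.\overline{i+1}$ with ramification $\emptyset$ followed by $(+,\alpha.\overline{i},\emptyset)$, and ramification $\{0\}$ followed by $(+,\alpha.\overline{i},\{0\})(-,\alpha.\overline{i}.0,\{1\})$ and then $\mathfrak{P}_{\overline{i+1}}$ on $\vdash\sigma.\overline{i+1}.0,\alpha.\overline{i+1}$. -}

module Defs where

open import Data.Nat using (ℕ; zero; suc; _≟_; _<_)
open import Data.List using (List; []; _∷_; _++_; _∷ʳ_; length; [_])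
open import Data.List.Membership.Propositional using (_∈_; _∉_)
open import Data.List.Relation.Unary.All using (All)
open import Data.List.Relation.Unary.Any using (Any)
open import Data.List.Relation.Unary.AllPairs using (AllPairs)
open import Data.List.Relation.Unary.Unique.Propositional using (Unique)
open import Data.Maybe using (Maybe; just; nothing; maybe; is-just)
open import Data.Product using (Σ; ∃; ∃-syntax; _×_; _,_; proj₁; proj₂)
open import Data.Sum using (_⊎_)
open import Data.Unit using (⊤)
open import Data.Empty using (⊥)
open import Data.Bool using (T)
open import Relation.Nullary using (¬_; yes; no)
open import Relation.Binary.PropositionalEquality using (_≡_; _≢_)

-- A locus (address) is a finite word of natural numbers; ξ.i = ξ · i.
Locus : Set
Locus = List ℕ

_·_ : Locus → ℕ → Locus
ξ · i = ξ ++ [ i ]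

-- A ramification is a finite set of natural numbers, represented
-- canonically by a strictly increasing list.
Ram : Set
Ram = List ℕ

data Pol : Set where
  pos neg : Pol

flip : Pol → Pol
flip pos = neg
flip neg = pos

-- dai is the daimon (positive); act p ξ I is the action (p, ξ, I).
data Action : Set where
  dai : Action
  act : Pol → Locus → Ram → Action

polA : Action → Pol
polA dai = pos
polA (act p _ _) = p

focus : Action → Maybe Locus
focus dai = nothing
focus (act _ ξ _) = just ξ

foci : List Action → List Locus
foci [] = []
foci (dai ∷ s) = foci s
foci (act _ ξ _ ∷ s) = ξ ∷ foci s

RamOK : Action → Set
RamOK dai = ⊤
RamOK (act _ _ I) = AllPairs _<_ I

IsPrefix : Locus → Locus → Set
IsPrefix β ζ = ∃[ w ] (β ++ w ≡ ζ)

record Base : Set where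
  constructor _⊢_
  field
    left  : Maybe Locus
    right : List Locus
open Base public

basePol : Base → Pol
basePol (just _ ⊢ _) = neg
basePol (nothing ⊢ _) = pos

data Alt : Pol → List Action → Set where
  alt[] : ∀ {p} → Alt p []
  alt∷  : ∀ {p κ s} → polA κ ≡ p → Alt (flip p) s → Alt p (κ ∷ s)

DaiLast : List Action → Set
DaiLast s = ∀ w r → s ≡ w ++ (dai ∷ r) → r ≡ []

Initial : Base → Pol → Locus → Set
Initial B neg ζ = left B ≡ just ζ
Initial B pos ζ = ζ ∈ right B

JustifiedBy : Base → List Action → Pol → Locus → Set
JustifiedBy B w p ζ =
  Initial B p ζ ⊎ (∃[ ξ ] ∃[ I ] ∃[ i ] (act (flip p) ξ I ∈ w × i ∈ I × ζ ≡ ξ · i))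

Justified : Base → List Action → Set
Justified B s = ∀ w p ζ I r → s ≡ w ++ (act p ζ I ∷ r) → JustifiedBy B w p ζ

Legal : Base → List Action → Set
Legal B s = Alt (basePol B) s × DaiLast s × Justified B s × Unique (foci s) × All RamOK s

ImmJust : List Action → Set
ImmJust c = ∀ w κ ζ J r → c ≡ w ++ (κ ∷ act neg ζ J ∷ r) →
  ∃[ ξ ] ∃[ I ] ∃[ i ] (κ ≡ act pos ξ I × i ∈ I × ζ ≡ ξ · i)

Chronicle : Base → List Action → Set
Chronicle B c = (c ≢ []) × Legal B c × ImmJust c

-- View B s v : v is the (player) view of the sequence s
data View (B : Base) : List Action → List Action → Set where
  v[]   : View B [] []
  vpos  : ∀ {s v κ} → polA κ ≡ pos → View B s v → View B (s ∷ʳ κ) (v ∷ʳ κ)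
  vinit : ∀ {s ζ J} → left B ≡ just ζ → View B (s ∷ʳ act neg ζ J) [ act neg ζ J ]
  vjust : ∀ {s₁ s₂ v ξ I ζ J i} → i ∈ I → ζ ≡ ξ · i →
          View B (s₁ ∷ʳ act pos ξ I) v →
          View B (((s₁ ∷ʳ act pos ξ I) ++ s₂) ∷ʳ act neg ζ J) (v ∷ʳ act neg ζ J)

DSet : Set₁
DSet = List Action → Set

record Design (B : Base) (D : DSet) : Set where
  field
    chron  : ∀ c → D c → Chronicle B c
    arbor  : ∀ c c' → c ≢ [] → D (c ++ c') → D c
    coher  : ∀ c₁ c₂ w κ₁ κ₂ r₁ r₂ → D c₁ → D c₂ →
             c₁ ≡ w ++ (κ₁ ∷ r₁) → c₂ ≡ w ++ (κ₂ ∷ r₂) → κ₁ ≢ κ₂ →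
             polA κ₁ ≡ neg × polA κ₂ ≡ neg ×
             (focus κ₁ ≢ focus κ₂ → ∀ ζ → ζ ∈ foci r₁ → ζ ∉ foci r₂)
    posit  : ∀ w κ → D (w ∷ʳ κ) → polA κ ≡ neg → ∃[ κ' ] D ((w ∷ʳ κ) ∷ʳ κ')
    total  : basePol B ≡ pos → ∃[ c ] D c

_≐_ : DSet → DSet → Set
D ≐ E = ∀ c → (D c → E c) × (E c → D c)

_⊆ᴰ_ : DSet → DSet → Set
D ⊆ᴰ E = ∀ c → D c → E c

PrefixOf : List Action → List Action → Set
PrefixOf c m = (c ≢ []) × ∃[ r ] (c ++ r ≡ m)

daiD : DSet
daiD c = c ≡ [ dai ]

Play : Base → DSet → List Action → Set
Play B D s = Legal B s ×
  (∀ w κ r → s ≡ (w ∷ʳ κ) ++ r → polA κ ≡ pos → ∀ v → View B (w ∷ʳ κ) v → D v)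

stripPrefix : Locus → Locus → Maybe (List ℕ)
stripPrefix [] ζ = just ζ
stripPrefix (x ∷ β) [] = nothing
stripPrefix (x ∷ β) (y ∷ ζ) with x ≟ y
... | yes _ = stripPrefix β ζ
... | no _ = nothing

parity : ℕ → Pol → Pol
parity zero p = p
parity (suc n) p = flip (parity n p)

under : Locus → Pol → Locus → Maybe Pol
under β p ζ = maybe (λ w → just (parity (length w) p)) nothing (stripPrefix β ζ)

firstJust : {A : Set} → List (Maybe A) → Maybe A
firstJust [] = nothing
firstJust (just a ∷ _) = just a
firstJust (nothing ∷ xs) = firstJust xs

mapL : {A B : Set} → (A → B) → List A → List B
mapL f [] = []
mapL f (x ∷ xs) = f x ∷ mapL f xs

-- polarity, relative to base B, of an action on locus ζ
-- (nothing if ζ is not hereditarily in B)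
locPol : Base → Locus → Maybe Pol
locPol (l ⊢ r) ζ =
  firstJust (maybe (λ β → under β neg ζ) nothing l ∷ mapL (λ β → under β pos ζ) r)

-- an (unpolarised) move of an interaction
Move : Set
Move = Locus × Ram

proj : Base → List Move → List Action
proj B [] = []
proj B ((ζ , I) ∷ u) with locPol B ζ
... | just p = act p ζ I ∷ proj B u
... | nothing = proj B u

Net : Set₁
Net = List (Base × DSet)

AllN : Net → (Base × DSet → Set) → Set
AllN [] P = ⊤
AllN (d ∷ R) P = P d × AllN R P

AnyN : Net → (Base × DSet → Set) → Set
AnyN [] P = ⊥
AnyN (d ∷ R) P = P d ⊎ AnyN R P

-- daimon-free interaction sequences of a cut-net
IntSeq : Net → List Move → Set
IntSeq R u =
  All (λ m → AnyN R (λ d → T (is-just (locPol (proj₁ d) (proj₁ m))))) u ×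
  AllN R (λ d → Play (proj₁ d) (proj₂ d) (proj (proj₁ d) u))

-- maximal chronicles of the normal form, on result base B
NFmax : Net → Base → DSet
NFmax R B c =
  (∃[ u ] (IntSeq R u × (∃[ w ] ∃[ κ ] (proj B u ≡ w ∷ʳ κ × polA κ ≡ pos)) ×
           View B (proj B u) c))
  ⊎
  (∃[ u ] (IntSeq R u ×
           AnyN R (λ d → Play (proj₁ d) (proj₂ d) (proj (proj₁ d) u ∷ʳ dai)) ×
           View B (proj B u ∷ʳ dai) c))

NF : Net → Base → DSet
NF R B c = ∃[ r ] ((c ≢ []) × NFmax R B (c ++ r))

natChron : Locus → ℕ → List Action
natChron ξ zero = act pos ξ [] ∷ []
natChron ξ (suc n) =
  act pos ξ (0 ∷ []) ∷ act neg (ξ · 0) (1 ∷ []) ∷ natChron ((ξ · 0) · 1) n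

natD : Locus → ℕ → DSet
natD ξ n c = PrefixOf c (natChron ξ n)

InNat : Locus → DSet → Set
InNat ξ D = ∃[ n ] (D ≐ natD ξ n)

⊢[_] : Locus → Base
⊢[ ξ ] = nothing ⊢ (ξ ∷ [])

[_]⊢ : Locus → Base
[ ξ ]⊢ = just ξ ⊢ []

_⊢₁_ : Locus → Locus → Base
σ ⊢₁ α = just σ ⊢ (α ∷ [])

⊢∅ : Base
⊢∅ = nothing ⊢ []

Disjoint : Locus → Locus → Set
Disjoint σ α = ¬ IsPrefix σ α × ¬ IsPrefix α σ

ImpProp : Locus → Locus → DSet → Set₁
ImpProp σ α D = ∀ (A : DSet) → InNat σ A →
  InNat α (NF ((σ ⊢₁ α , D) ∷ (⊢[ σ ] , A) ∷ []) ⊢[ α ])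

NatImp : Locus → Locus → DSet → Set₁
NatImp σ α D =
  Design (σ ⊢₁ α) D × ImpProp σ α D ×
  (∀ (D' : DSet) → Design (σ ⊢₁ α) D' → ImpProp σ α D' → D' ⊆ᴰ D → D ⊆ᴰ D')

-- Orthogonality for designs on base σ ⊢ α: counter-designs are
-- families (A on ⊢σ, B on α⊢), forming a closed cut-net with D.

closedNet : Locus → Locus → DSet → DSet → DSet → Net
closedNet σ α D A B = (σ ⊢₁ α , D) ∷ (⊢[ σ ] , A) ∷ ([ α ]⊢ , B) ∷ []

Orth : Locus → Locus → (DSet → Set₁) → DSet → DSet → Set₁
Orth σ α E A B = Design ⊢[ σ ] A × Design [ α ]⊢ B ×
  (∀ (D : DSet) → E D → NF (closedNet σ α D A B) ⊢∅ ≐ daiD)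

BiOrth : Locus → Locus → (DSet → Set₁) → DSet → Set₁
BiOrth σ α E D = Design (σ ⊢₁ α) D ×
  (∀ (A B : DSet) → Orth σ α E A B → NF (closedNet σ α D A B) ⊢∅ ≐ daiD)

bar : ℕ → Locus → Locus
bar zero ξ = ξ
bar (suc i) ξ = (bar i ξ · 0) · 1

spine : Locus → Locus → ℕ → List Action
spine σ α zero = act neg σ (0 ∷ []) ∷ []
spine σ α (suc k) = spine σ α k ++
  (act pos (bar k σ · 0) (1 ∷ []) ∷ act neg (bar (suc k) σ) (0 ∷ []) ∷
   act pos (bar k α) (0 ∷ []) ∷ act neg (bar k α · 0) (1 ∷ []) ∷ [])

pDai : Locus → List Action
pDai σ = act neg σ [] ∷ dai ∷ []

pEnd : Locus → Locus → ℕ → List Action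
pEnd σ α k = spine σ α k ++
  (act pos (bar k σ · 0) (1 ∷ []) ∷ act neg (bar (suc k) σ) [] ∷
   act pos (bar k α) [] ∷ [])

Pred : Locus → Locus → DSet
Pred σ α c = PrefixOf c (pDai σ) ⊎ ∃[ k ] PrefixOf c (pEnd σ α k)

predNet : Locus → Locus → ℕ → Net
predNet σ α n = (σ ⊢₁ α , Pred σ α) ∷ (⊢[ σ ] , natD σ n) ∷ []

module Submission where

-- The chronicles of P form an explicit tree, whose nodes (data Node) we enumerate together
-- with the chronicle leading to each of them.  We treat at once a family P_b (module PredTree)
-- differing only in the answer to the input 0: the daimon (b = false, which is P itself) or
-- (+,α,∅) (b = true, a design P' computing 0 ↦ 0).  After general facts on legal sequences,
-- views and plays (module Sequences) and on the loci σ.i̅, α.i̅ (module Loci), the core is a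
-- reachability invariant (module Interaction): every interaction of {P_b, n} follows the
-- chronicle of a node admissible for n, or stops at a dead end.  Reading off the output
-- projections (module NormalForm) gives the normal forms: {✠} for n = 0 when b = false, and
-- n − 1 otherwise.  This yields the first and the last claim, and P ∉ Nat ⇒ Nat since {✠} is
-- not an integer.  For the biorthogonal (module Theorem) we show P' ∈ Nat ⇒ Nat, minimality
-- coming from the fact that each maximal chronicle of P' is traversed on the input it serves;
-- then a converging interaction of P' with a counter-design yields one of P: either σ is opened
-- with ∅ and P plays ✠ at once, or P and P' coincide along the interaction.

open import Defs
open import Data.Nat using (ℕ; zero; suc; _≟_; _<_; _≤_; _+_; _∸_; s≤s; z≤n)
import Data.Nat.Properties as NP
open import Data.Bool using (Bool; true; false) renaming (T to TT)
open import Data.List using (List; []; _∷_; _++_; _∷ʳ_; length; [_])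
import Data.List.Properties as LP
open import Data.List.Membership.Propositional using (_∈_; _∉_)
open import Data.List.Membership.Propositional.Properties using (∈-++⁻; ∈-++⁺ˡ; ∈-++⁺ʳ)
open import Data.List.Relation.Unary.Any using (here; there)
open import Data.List.Relation.Unary.All as All using (All; []; _∷_)
import Data.List.Relation.Unary.All.Properties as AllP
open import Data.List.Relation.Unary.AllPairs using (AllPairs; []; _∷_)
open import Data.List.Relation.Unary.Unique.Propositional using (Unique)
open import Data.Maybe using (Maybe; just; nothing; is-just; maybe)
open import Data.Product using (∃; ∃-syntax; _×_; _,_; proj₁; proj₂)
open import Data.Sum using (_⊎_; inj₁; inj₂)
open import Data.Empty using (⊥; ⊥-elim)
open import Data.Unit using (⊤; tt)
open import Relation.Nullary using (¬_; yes; no)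
open import Relation.Binary.PropositionalEquality using (_≡_; _≢_; refl; sym; trans; cong; cong₂; subst)

module Sequences where

  snoc≢[] : ∀ {A : Set} (s : List A) x → s ∷ʳ x ≢ []
  snoc≢[] [] x ()
  snoc≢[] (y ∷ s) x ()

  snoc-view : ∀ {A : Set} (s : List A) → s ≡ [] ⊎ ∃[ s' ] ∃[ x ] (s ≡ s' ∷ʳ x)
  snoc-view [] = inj₁ refl
  snoc-view (y ∷ s) with snoc-view s
  ... | inj₁ refl = inj₂ ([] , y , refl)
  ... | inj₂ (s' , x , refl) = inj₂ (y ∷ s' , x , refl)

  snoc-inj : ∀ {A : Set} {xs ys : List A} {x y} → xs ∷ʳ x ≡ ys ∷ʳ y → xs ≡ ys × x ≡ y
  snoc-inj {xs = xs} {ys} e = LP.∷ʳ-injective xs ys e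

  ++∷≢[] : ∀ {A : Set} (w : List A) x r → w ++ (x ∷ r) ≢ []
  ++∷≢[] [] x r ()
  ++∷≢[] (y ∷ w) x r ()

  decomp : ∀ {A : Set} (s : List A) κ w κ' r → s ∷ʳ κ ≡ w ++ (κ' ∷ r) →
    (r ≡ [] × w ≡ s × κ' ≡ κ) ⊎ (∃[ r' ] (r ≡ r' ∷ʳ κ × s ≡ w ++ (κ' ∷ r')))
  decomp [] κ [] κ' r refl = inj₁ (refl , refl , refl)
  decomp (y ∷ s) κ [] κ' r refl = inj₂ (s , refl , refl)
  decomp [] κ (x ∷ w) κ' r e with LP.∷-injective e
  ... | _ , e' = ⊥-elim (++∷≢[] w κ' r (sym e'))
  decomp (y ∷ s) κ (x ∷ w) κ' r e with LP.∷-injective e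
  ... | refl , e' with decomp s κ w κ' r e'
  ... | inj₁ (a , refl , c) = inj₁ (a , refl , c)
  ... | inj₂ (r' , a , refl) = inj₂ (r' , a , refl)

  alt-one : ∀ {p κ} → polA κ ≡ p → Alt p [ κ ]
  alt-one e = alt∷ e alt[]

  alt-head : ∀ {p κ r} → Alt p (κ ∷ r) → polA κ ≡ p
  alt-head (alt∷ e _) = e

  alt-snoc2 : ∀ {p} (s : List Action) x κ → Alt p (s ∷ʳ x) → polA κ ≡ flip (polA x) → Alt p ((s ∷ʳ x) ∷ʳ κ)
  alt-snoc2 [] x κ (alt∷ e alt[]) e' = alt∷ e (alt∷ (trans e' (cong flip e)) alt[])
  alt-snoc2 (y ∷ s) x κ (alt∷ e a) e' = alt∷ e (alt-snoc2 s x κ a e')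

  alt-snoc2⁻ : ∀ {p} (s : List Action) x κ → Alt p ((s ∷ʳ x) ∷ʳ κ) → polA κ ≡ flip (polA x)
  alt-snoc2⁻ [] x κ (alt∷ e (alt∷ e' alt[])) = trans e' (cong flip (sym e))
  alt-snoc2⁻ (y ∷ s) x κ (alt∷ e a) = alt-snoc2⁻ s x κ a

  alt-prefix : ∀ {p} (s t : List Action) → Alt p (s ++ t) → Alt p s
  alt-prefix [] t a = alt[]
  alt-prefix (x ∷ s) t (alt∷ e a) = alt∷ e (alt-prefix s t a)

  just-snoc : ∀ {B} (s : List Action) κ → Justified B s →
    (∀ p ζ I → κ ≡ act p ζ I → JustifiedBy B s p ζ) → Justified B (s ∷ʳ κ)
  just-snoc s κ J h w p ζ I r e with decomp s κ w (act p ζ I) r e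
  ... | inj₁ (_ , refl , e') = h p ζ I (sym e')
  ... | inj₂ (r' , _ , e') = J w p ζ I r' e'

  just-snoc⁻ : ∀ {B} (s : List Action) p ζ I → Justified B (s ∷ʳ act p ζ I) → JustifiedBy B s p ζ
  just-snoc⁻ s p ζ I J = J s p ζ I [] refl

  just-prefix : ∀ {B} (s t : List Action) → Justified B (s ++ t) → Justified B s
  just-prefix s t J w p ζ I r e = J w p ζ I (r ++ t) (trans (cong (_++ t) e) (LP.++-assoc w (act p ζ I ∷ r) t))

  NoDai : List Action → Set
  NoDai s = All (λ κ → κ ≢ dai) s

  nodai-dl : ∀ s → NoDai s → DaiLast s
  nodai-dl s nd w r e = ⊥-elim (All.lookup nd (subst (dai ∈_) (sym e) (∈-++⁺ʳ w (here refl))) refl)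

  dl-dai : ∀ s → NoDai s → DaiLast (s ∷ʳ dai)
  dl-dai s nd w r e with decomp s dai w dai r e
  ... | inj₁ (r≡ , _ , _) = r≡
  ... | inj₂ (r' , _ , e') = ⊥-elim (All.lookup nd (subst (dai ∈_) (sym e') (∈-++⁺ʳ w (here refl))) refl)

  nodai-snoc : ∀ s κ → NoDai s → κ ≢ dai → NoDai (s ∷ʳ κ)
  nodai-snoc s κ nd ne = AllP.++⁺ nd (ne ∷ [])

  uniq-snoc : ∀ {A : Set} (xs : List A) y → Unique xs → y ∉ xs → Unique (xs ∷ʳ y)
  uniq-snoc [] y u n = [] ∷ []
  uniq-snoc (x ∷ xs) y (px ∷ u) n = AllP.++⁺ px ((λ e → n (here (sym e))) ∷ []) ∷ uniq-snoc xs y u (λ m → n (there m))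

  uniq-snoc⁻ : ∀ {A : Set} (xs : List A) y → Unique (xs ∷ʳ y) → y ∉ xs
  uniq-snoc⁻ (x ∷ xs) y (px ∷ u) (here refl) = All.lookup px (∈-++⁺ʳ xs (here refl)) refl
  uniq-snoc⁻ (x ∷ xs) y (px ∷ u) (there m) = uniq-snoc⁻ xs y u m

  uniq-prefix : ∀ {A : Set} (xs ys : List A) → Unique (xs ++ ys) → Unique xs
  uniq-prefix [] ys u = []
  uniq-prefix (x ∷ xs) ys (px ∷ u) = AllP.++⁻ˡ xs px ∷ uniq-prefix xs ys u

  foci-++ : ∀ s t → foci (s ++ t) ≡ foci s ++ foci t
  foci-++ [] t = refl
  foci-++ (dai ∷ s) t = foci-++ s t
  foci-++ (act p ξ I ∷ s) t = cong (ξ ∷_) (foci-++ s t)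

  foci-∈ : ∀ {s p ζ I} → act p ζ I ∈ s → ζ ∈ foci s
  foci-∈ {dai ∷ s} (here ())
  foci-∈ {dai ∷ s} (there m) = foci-∈ {s} m
  foci-∈ {act _ _ _ ∷ s} (here refl) = here refl
  foci-∈ {act _ _ _ ∷ s} (there m) = there (foci-∈ {s} m)

  -- A daimon-free legal sequence, with the legality conditions as fields; it is the
  -- invariant maintained when chronicles are built action by action.
  record Good (B : Base) (s : List Action) : Set where
    constructor good
    field
      galt : Alt (basePol B) s
      gnd : NoDai s
      gjust : Justified B s
      guniq : Unique (foci s)
      gram : All RamOK s
  open Good public

  good→legal : ∀ {B s} → Good B s → Legal B s
  good→legal {s = s} (good a n j u r) = a , nodai-dl s n , j , u , r

  good[] : ∀ {B} → Good B []
  good[] = good alt[] [] (λ w p ζ I r e → ⊥-elim (++∷≢[] w _ r (sym e))) [] []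

  good-snoc : ∀ {B} s p ζ I → Good B s → Alt (basePol B) (s ∷ʳ act p ζ I) → JustifiedBy B s p ζ →
    ζ ∉ foci s → AllPairs _<_ I → Good B (s ∷ʳ act p ζ I)
  good-snoc s p ζ I (good a n j u r) a' jb nf ram =
    good a' (nodai-snoc s _ n (λ ())) (just-snoc s _ j (λ { p' ζ' I' refl → jb }))
         (subst Unique (sym (foci-++ s _)) (uniq-snoc (foci s) ζ u nf)) (AllP.++⁺ r (ram ∷ []))

  legal-dai : ∀ {B s} → Good B s → Alt (basePol B) (s ∷ʳ dai) → Legal B (s ∷ʳ dai)
  legal-dai {s = s} (good a n j u r) a' =
    a' , dl-dai s n , just-snoc s dai j (λ _ _ _ ()) ,
    subst Unique (sym (trans (foci-++ s [ dai ]) (LP.++-identityʳ _))) u , AllP.++⁺ r (tt ∷ [])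

  legal-prefix : ∀ {B} s t → Legal B (s ++ t) → Legal B s
  legal-prefix s t (a , d , j , u , r) =
    alt-prefix s t a ,
    (λ w r' e → LP.++-conicalˡ r' t (d w (r' ++ t) (trans (cong (_++ t) e) (LP.++-assoc w (dai ∷ r') t)))) ,
    just-prefix s t j ,
    uniq-prefix (foci s) (foci t) (subst Unique (foci-++ s t) u) ,
    AllP.++⁻ˡ s r

  play-prefix : ∀ {B D} s t → Play B D (s ++ t) → Play B D s
  play-prefix s t (l , h) = legal-prefix s t l ,
    λ w κ r e pk v vw → h w κ (r ++ t) (trans (cong (_++ t) e) (LP.++-assoc (w ∷ʳ κ) r t)) pk v vw

  proj-++ : ∀ B u v → proj B (u ++ v) ≡ proj B u ++ proj B v
  proj-++ B [] v = refl
  proj-++ B ((ζ , I) ∷ u) v with locPol B ζ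
  ... | just p = cong (act p ζ I ∷_) (proj-++ B u v)
  ... | nothing = proj-++ B u v

  AllN-map : ∀ R {P Q : Base × DSet → Set} → (∀ d → P d → Q d) → AllN R P → AllN R Q
  AllN-map [] f tt = tt
  AllN-map (d ∷ R) f (p , ps) = f d p , AllN-map R f ps

  intseq-prefix : ∀ R u v → IntSeq R (u ++ v) → IntSeq R u
  intseq-prefix R u v (a , ps) = AllP.++⁻ˡ u a ,
    AllN-map R (λ d play → play-prefix (proj (proj₁ d) u) (proj (proj₁ d) v)
      (subst (Play (proj₁ d) (proj₂ d)) (proj-++ (proj₁ d) u v) play)) ps

  -- Sequences equal to their own view: every negative action is initial or justified by the
  -- action just before it.  Chronicles are self-viewed, and so are all plays of P and of n.
  data SelfView (B : Base) : List Action → Set where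
    sv[] : SelfView B []
    svPos : ∀ {s κ} → polA κ ≡ pos → (left B ≡ nothing ⊎ s ≢ []) → SelfView B s → SelfView B (s ∷ʳ κ)
    svInit : ∀ {ζ J} → left B ≡ just ζ → SelfView B [ act neg ζ J ]
    svJust : ∀ {s ξ I ζ J i} → i ∈ I → ζ ≡ ξ · i → SelfView B (s ∷ʳ act pos ξ I) →
            SelfView B ((s ∷ʳ act pos ξ I) ∷ʳ act neg ζ J)

  view-self : ∀ {B s} → SelfView B s → View B s s
  view-self sv[] = v[]
  view-self (svPos e _ r) = vpos e (view-self r)
  view-self (svInit e) = vinit {s = []} e
  view-self {B} (svJust {s} {ξ} {I} {ζ} {J} m e r) =
    subst (λ t → View B (t ∷ʳ act neg ζ J) ((s ∷ʳ act pos ξ I) ∷ʳ act neg ζ J))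
          (LP.++-identityʳ _) (vjust {s₂ = []} m e (view-self r))

  selfView-init : ∀ {B u} → SelfView B u → ∀ {s κ} → u ≡ s ∷ʳ κ → SelfView B s
  selfView-init sv[] {s} {κ} e = ⊥-elim (snoc≢[] s κ (sym e))
  selfView-init (svPos _ _ r) e with snoc-inj e
  ... | refl , _ = r
  selfView-init (svInit _) {s} e with snoc-inj {xs = []} {ys = s} e
  ... | refl , _ = sv[]
  selfView-init (svJust _ _ r) e with snoc-inj e
  ... | refl , _ = r

  selfView-neg : ∀ {B u} → SelfView B u → ∀ {t ζ J} → u ≡ t ∷ʳ act neg ζ J →
    t ≡ [] ⊎ ∃[ s' ] ∃[ ξ' ] ∃[ I' ] ∃[ i' ] (t ≡ s' ∷ʳ act pos ξ' I' × i' ∈ I' × ζ ≡ ξ' · i')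
  selfView-neg sv[] {t} {ζ} {J} e = ⊥-elim (snoc≢[] t _ (sym e))
  selfView-neg (svPos pe _ _) e with snoc-inj e
  selfView-neg (svPos () _ _) e | _ , refl
  selfView-neg (svInit _) {t} e with snoc-inj {xs = []} {ys = t} e
  ... | refl , _ = inj₁ refl
  selfView-neg (svJust {s} {ξ} {I} {i = i} m eq _) e with snoc-inj e
  ... | refl , refl = inj₂ (s , ξ , I , i , refl , m , eq)

  foci-snoc-∈ : ∀ s κ {ζ} → ζ ∈ foci s → ζ ∈ foci (s ∷ʳ κ)
  foci-snoc-∈ s κ {ζ} m = subst (ζ ∈_) (sym (foci-++ s [ κ ])) (∈-++⁺ˡ m)

  uniq-foci-prefix : ∀ s t → Unique (foci (s ++ t)) → Unique (foci s)
  uniq-foci-prefix s t u = uniq-prefix (foci s) (foci t) (subst Unique (foci-++ s t) u)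

  uniq-foci-snoc⁻ : ∀ s p ζ I → Unique (foci (s ∷ʳ act p ζ I)) → ζ ∉ foci s
  uniq-foci-snoc⁻ s p ζ I u = uniq-snoc⁻ (foci s) ζ (subst Unique (foci-++ s _) u)

  left-in-foci : ∀ {B s ζ} → SelfView B s → s ≢ [] → left B ≡ just ζ → ζ ∈ foci s
  left-in-foci sv[] ne e = ⊥-elim (ne refl)
  left-in-foci (svPos {s} {κ} _ (inj₁ e') r) ne e with trans (sym e') e
  ... | ()
  left-in-foci (svPos {s} {κ} _ (inj₂ ne') r) ne e = foci-snoc-∈ s κ (left-in-foci r ne' e)
  left-in-foci (svInit e') ne e with trans (sym e') e
  ... | refl = here refl
  left-in-foci (svJust {s} {ξ} {I} {ζ'} {J} _ _ r) ne e = foci-snoc-∈ (s ∷ʳ act pos ξ I) (act neg ζ' J) (left-in-foci r (snoc≢[] s (act pos ξ I)) e)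

  -- Views are unique on linear self-viewed sequences: the view of such a sequence is itself.
  -- This is what allows reading the chronicles of a design off its plays.
  view-unique : ∀ {B s v} → View B s v → SelfView B s → Unique (foci s) → v ≡ s
  view-unique v[] _ _ = refl
  view-unique (vpos {s} {v} {κ} e d) is u =
    cong (_∷ʳ κ) (view-unique d (selfView-init is refl) (uniq-foci-prefix s [ κ ] u))
  view-unique (vinit {s} {ζ} {J} e) is u with snoc-view s
  ... | inj₁ refl = refl
  ... | inj₂ (s' , x , refl) =
    ⊥-elim (uniq-foci-snoc⁻ (s' ∷ʳ x) neg ζ J u (left-in-foci (selfView-init is refl) (snoc≢[] s' x) e))
  view-unique {B} (vjust {s₁} {s₂} {v} {ξ} {I} {ζ} {J} {i} m e d) is u
    with selfView-neg is refl
  ... | inj₁ t≡ = ⊥-elim (++∷≢[] s₁ (act pos ξ I) s₂ (trans (sym (LP.++-assoc s₁ [ act pos ξ I ] s₂)) t≡))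
  ... | inj₂ (s' , ξ' , I' , i' , teq , m' , e') with snoc-view s₂
  ... | inj₁ refl =
    let is' = subst (SelfView B) (LP.++-identityʳ (s₁ ∷ʳ act pos ξ I)) (selfView-init is refl)
        u' = subst (λ t → Unique (foci t)) (LP.++-identityʳ (s₁ ∷ʳ act pos ξ I)) (uniq-foci-prefix ((s₁ ∷ʳ act pos ξ I) ++ []) [ act neg ζ J ] u)
    in cong (_∷ʳ act neg ζ J) (trans (view-unique d is' u') (sym (LP.++-identityʳ (s₁ ∷ʳ act pos ξ I))))
  ... | inj₂ (s₂' , y , refl) =
    let teq' : ((s₁ ∷ʳ act pos ξ I) ++ s₂') ∷ʳ y ≡ s' ∷ʳ act pos ξ' I'
        teq' = trans (LP.++-assoc (s₁ ∷ʳ act pos ξ I) s₂' [ y ]) teq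
        yeq = proj₂ (snoc-inj teq')
        ξeq : ξ ≡ ξ'
        ξeq = proj₁ (snoc-inj {xs = ξ} {ys = ξ'} (trans (sym e) e'))
        u1 = uniq-foci-prefix ((s₁ ∷ʳ act pos ξ I) ++ (s₂' ∷ʳ y)) [ act neg ζ J ] u
        u2 = subst (λ t → Unique (foci t)) (trans (sym (LP.++-assoc (s₁ ∷ʳ act pos ξ I) s₂' [ y ])) (cong (((s₁ ∷ʳ act pos ξ I) ++ s₂') ∷ʳ_) yeq)) u1
        inn : ξ' ∈ foci ((s₁ ∷ʳ act pos ξ I) ++ s₂')
        inn = subst (ξ' ∈_) (sym (foci-++ (s₁ ∷ʳ act pos ξ I) s₂'))
                (∈-++⁺ˡ (subst (ξ' ∈_) (sym (foci-++ s₁ [ act pos ξ I ])) (∈-++⁺ʳ (foci s₁) (here (sym ξeq)))))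
    in ⊥-elim (uniq-foci-snoc⁻ ((s₁ ∷ʳ act pos ξ I) ++ s₂') pos ξ' I' u2 inn)

  view-sub : ∀ {B s v} → View B s v → ∀ {x} → x ∈ v → x ∈ s
  view-sub v[] m = m
  view-sub (vpos {s} {v} {κ} e d) m with ∈-++⁻ v m
  ... | inj₁ m' = ∈-++⁺ˡ (view-sub d m')
  ... | inj₂ m' = ∈-++⁺ʳ s m'
  view-sub (vinit {s} e) (here refl) = ∈-++⁺ʳ s (here refl)
  view-sub (vjust {s₁} {s₂} {v} d₁ d₂ d) m with ∈-++⁻ v m
  ... | inj₁ m' = ∈-++⁺ˡ (∈-++⁺ˡ (view-sub d m'))
  ... | inj₂ m' = ∈-++⁺ʳ ((s₁ ∷ʳ _) ++ s₂) m'

module Loci (σ α : Locus) (dis : Disjoint σ α) where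
  open Sequences

  app-prefix : (a b c d : List ℕ) → a ++ b ≡ c ++ d → IsPrefix a c ⊎ IsPrefix c a
  app-prefix [] b c d e = inj₁ (c , refl)
  app-prefix (x ∷ a) b [] d e = inj₂ (x ∷ a , refl)
  app-prefix (x ∷ a) b (y ∷ c) d e with LP.∷-injective e
  ... | refl , e' with app-prefix a b c d e'
  ... | inj₁ (w , refl) = inj₁ (w , refl)
  ... | inj₂ (w , refl) = inj₂ (w , refl)

  σ++≢α++ : ∀ w w' → σ ++ w ≢ α ++ w'
  σ++≢α++ w w' e with app-prefix σ w α w' e
  ... | inj₁ p = proj₁ dis p
  ... | inj₂ p = proj₂ dis p

  bar-app : ∀ j ξ → bar j ξ ≡ ξ ++ bar j []
  bar-app zero ξ = sym (LP.++-identityʳ ξ)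
  bar-app (suc j) ξ = trans (cong (λ t → (t ++ [ 0 ]) ++ [ 1 ]) (bar-app j ξ))
    (trans (cong (_++ [ 1 ]) (LP.++-assoc ξ (bar j []) [ 0 ])) (LP.++-assoc ξ (bar j [] ++ [ 0 ]) [ 1 ]))

  bar-inj : ∀ i j → bar i [] ≡ bar j [] → i ≡ j
  bar-inj zero zero e = refl
  bar-inj zero (suc j) e = ⊥-elim (snoc≢[] _ _ (sym e))
  bar-inj (suc i) zero e = ⊥-elim (snoc≢[] _ _ e)
  bar-inj (suc i) (suc j) e = cong suc (bar-inj i j (proj₁ (snoc-inj (proj₁ (snoc-inj e)))))

  -- No word i̅.0 is a word j̅ (they have odd and even length).
  bar0≢ : ∀ i j → bar i [] ∷ʳ 0 ≢ bar j []
  bar0≢ i zero e = snoc≢[] _ _ e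
  bar0≢ i (suc j) e with proj₂ (snoc-inj {xs = bar i []} {ys = bar j [] ∷ʳ 0} e)
  ... | ()

  -- Codes of the loci used by P: σ.j̅ (sg), σ.j̅.0 (sg0), α.j̅ (al) and α.j̅.0 (al0).
  data Code : Set where
    sg sg0 al al0 : ℕ → Code

  ⟦_⟧ : Code → Locus
  ⟦ sg j ⟧ = bar j σ
  ⟦ sg0 j ⟧ = bar j σ · 0
  ⟦ al j ⟧ = bar j α
  ⟦ al0 j ⟧ = bar j α · 0

  codeTail : Code → Locus
  codeTail (sg j) = bar j []
  codeTail (sg0 j) = bar j [] · 0
  codeTail (al j) = bar j []
  codeTail (al0 j) = bar j [] · 0

  codeBase : Code → Locus
  codeBase (sg _) = σ
  codeBase (sg0 _) = σ
  codeBase (al _) = α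
  codeBase (al0 _) = α

  split0 : ∀ j ξ → bar j ξ · 0 ≡ ξ ++ (bar j [] · 0)
  split0 j ξ = trans (cong (_++ [ 0 ]) (bar-app j ξ)) (LP.++-assoc ξ (bar j []) [ 0 ])

  split : ∀ c → ⟦ c ⟧ ≡ codeBase c ++ codeTail c
  split (sg j) = bar-app j σ
  split (sg0 j) = split0 j σ
  split (al j) = bar-app j α
  split (al0 j) = split0 j α

  ⟦⟧-inj : ∀ a b → ⟦ a ⟧ ≡ ⟦ b ⟧ → a ≡ b
  ⟦⟧-inj a b e = go a b (trans (sym (split a)) (trans e (split b)))
    where
    cσ = LP.++-cancelˡ σ
    cα = LP.++-cancelˡ α
    go : ∀ a b → codeBase a ++ codeTail a ≡ codeBase b ++ codeTail b → a ≡ b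
    go (sg i) (sg j) e = cong sg (bar-inj i j (cσ _ _ e))
    go (sg i) (sg0 j) e = ⊥-elim (bar0≢ j i (sym (cσ _ _ e)))
    go (sg i) (al j) e = ⊥-elim (σ++≢α++ _ _ e)
    go (sg i) (al0 j) e = ⊥-elim (σ++≢α++ _ _ e)
    go (sg0 i) (sg j) e = ⊥-elim (bar0≢ i j (cσ _ _ e))
    go (sg0 i) (sg0 j) e = cong sg0 (bar-inj i j (proj₁ (snoc-inj (cσ _ _ e))))
    go (sg0 i) (al j) e = ⊥-elim (σ++≢α++ _ _ e)
    go (sg0 i) (al0 j) e = ⊥-elim (σ++≢α++ _ _ e)
    go (al i) (sg j) e = ⊥-elim (σ++≢α++ _ _ (sym e))
    go (al i) (sg0 j) e = ⊥-elim (σ++≢α++ _ _ (sym e))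
    go (al i) (al j) e = cong al (bar-inj i j (cα _ _ e))
    go (al i) (al0 j) e = ⊥-elim (bar0≢ j i (sym (cα _ _ e)))
    go (al0 i) (sg j) e = ⊥-elim (σ++≢α++ _ _ (sym e))
    go (al0 i) (sg0 j) e = ⊥-elim (σ++≢α++ _ _ (sym e))
    go (al0 i) (al j) e = ⊥-elim (bar0≢ i j (cα _ _ e))
    go (al0 i) (al0 j) e = cong al0 (bar-inj i j (proj₁ (snoc-inj (cα _ _ e))))

  strip-app : ∀ β w → stripPrefix β (β ++ w) ≡ just w
  strip-app [] w = refl
  strip-app (x ∷ β) w with x ≟ x
  ... | yes _ = strip-app β w
  ... | no ¬p = ⊥-elim (¬p refl)

  strip-just : ∀ β ζ {w} → stripPrefix β ζ ≡ just w → β ++ w ≡ ζ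
  strip-just [] ζ refl = refl
  strip-just (x ∷ β) [] ()
  strip-just (x ∷ β) (y ∷ ζ) e with x ≟ y
  ... | yes refl = cong (x ∷_) (strip-just β ζ e)
  strip-just (x ∷ β) (y ∷ ζ) () | no _

  strip-σα : ∀ w → stripPrefix σ (α ++ w) ≡ nothing
  strip-σα w with stripPrefix σ (α ++ w) in eq
  ... | nothing = refl
  ... | just w' = ⊥-elim (σ++≢α++ w' w (strip-just σ (α ++ w) eq))

  strip-ασ : ∀ w → stripPrefix α (σ ++ w) ≡ nothing
  strip-ασ w with stripPrefix α (σ ++ w) in eq
  ... | nothing = refl
  ... | just w' = ⊥-elim (σ++≢α++ w w' (sym (strip-just α (σ ++ w) eq)))

  len-snoc : ∀ {A : Set} (xs : List A) x → length (xs ∷ʳ x) ≡ suc (length xs)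
  len-snoc [] x = refl
  len-snoc (y ∷ xs) x = cong suc (len-snoc xs x)

  flip-flip : ∀ p → flip (flip p) ≡ p
  flip-flip pos = refl
  flip-flip neg = refl

  -- The words j̅ have even length, so they preserve the polarity of their base.
  parity-bar : ∀ j p → parity (length (bar j [])) p ≡ p
  parity-bar zero p = refl
  parity-bar (suc j) p rewrite len-snoc (bar j [] ∷ʳ 0) 1 | len-snoc (bar j []) 0 =
    trans (flip-flip _) (parity-bar j p)

  -- The words j̅.0 have odd length, so they flip the polarity of their base.
  parity-bar0 : ∀ j p → parity (length (bar j [] · 0)) p ≡ flip p
  parity-bar0 j p rewrite len-snoc (bar j []) 0 = cong flip (parity-bar j p)

  codePol : Code → Pol
  codePol (sg _) = neg
  codePol (sg0 _) = pos
  codePol (al _) = pos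
  codePol (al0 _) = neg

  baseP baseIn baseOut : Base
  baseP = σ ⊢₁ α
  baseIn = ⊢[ σ ]
  baseOut = ⊢[ α ]

  polP-σ : ∀ w → locPol baseP (σ ++ w) ≡ just (parity (length w) neg)
  polP-σ w rewrite strip-app σ w = refl

  polP-α : ∀ w → locPol baseP (α ++ w) ≡ just (parity (length w) pos)
  polP-α w rewrite strip-σα w | strip-app α w = refl

  polIn-σ : ∀ w → locPol baseIn (σ ++ w) ≡ just (parity (length w) pos)
  polIn-σ w rewrite strip-app σ w = refl

  polIn-α : ∀ w → locPol baseIn (α ++ w) ≡ nothing
  polIn-α w rewrite strip-σα w = refl

  polOut-α : ∀ w → locPol baseOut (α ++ w) ≡ just (parity (length w) pos)
  polOut-α w rewrite strip-app α w = refl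

  polOut-σ : ∀ w → locPol baseOut (σ ++ w) ≡ nothing
  polOut-σ w rewrite strip-ασ w = refl

  polP : ∀ c → locPol baseP ⟦ c ⟧ ≡ just (codePol c)
  polP (sg j) rewrite split (sg j) = trans (polP-σ (bar j [])) (cong just (parity-bar j neg))
  polP (sg0 j) rewrite split (sg0 j) = trans (polP-σ (bar j [] · 0)) (cong just (parity-bar0 j neg))
  polP (al j) rewrite split (al j) = trans (polP-α (bar j [])) (cong just (parity-bar j pos))
  polP (al0 j) rewrite split (al0 j) = trans (polP-α (bar j [] · 0)) (cong just (parity-bar0 j pos))

  polIn-sg : ∀ j → locPol baseIn ⟦ sg j ⟧ ≡ just pos
  polIn-sg j rewrite split (sg j) = trans (polIn-σ (bar j [])) (cong just (parity-bar j pos))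

  polIn-sg0 : ∀ j → locPol baseIn ⟦ sg0 j ⟧ ≡ just neg
  polIn-sg0 j rewrite split (sg0 j) = trans (polIn-σ (bar j [] · 0)) (cong just (parity-bar0 j pos))

  polIn-al : ∀ j → locPol baseIn ⟦ al j ⟧ ≡ nothing
  polIn-al j rewrite split (al j) = polIn-α _

  polIn-al0 : ∀ j → locPol baseIn ⟦ al0 j ⟧ ≡ nothing
  polIn-al0 j rewrite split (al0 j) = polIn-α _

  polOut-al : ∀ j → locPol baseOut ⟦ al j ⟧ ≡ just pos
  polOut-al j rewrite split (al j) = trans (polOut-α (bar j [])) (cong just (parity-bar j pos))

  polOut-al0 : ∀ j → locPol baseOut ⟦ al0 j ⟧ ≡ just neg
  polOut-al0 j rewrite split (al0 j) = trans (polOut-α (bar j [] · 0)) (cong just (parity-bar0 j pos))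

  polOut-sg : ∀ j → locPol baseOut ⟦ sg j ⟧ ≡ nothing
  polOut-sg j rewrite split (sg j) = polOut-σ _

  polOut-sg0 : ∀ j → locPol baseOut ⟦ sg0 j ⟧ ≡ nothing
  polOut-sg0 j rewrite split (sg0 j) = polOut-σ _

  in→P : ∀ ζ {q} → locPol baseIn ζ ≡ just q → locPol baseP ζ ≡ just (flip q)
  in→P ζ e with stripPrefix σ ζ
  in→P ζ refl | just w = cong just (parity-flip (length w))
    where
    parity-flip : ∀ n → parity n neg ≡ flip (parity n pos)
    parity-flip zero = refl
    parity-flip (suc n) = cong flip (parity-flip n)
  in→P ζ () | nothing

-- The tree of chronicles of the design P_b; b selects the answer to 0 (false: ✠, true: (+,α,∅)).
module PredTree (σ α : Locus) (dis : Disjoint σ α) (b : Bool) where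
  open Sequences

  open Loci σ α dis

  zeroAnswerOf : Bool → Action
  zeroAnswerOf true = act pos ⟦ al 0 ⟧ []
  zeroAnswerOf false = dai

  zeroAnswer : Action
  zeroAnswer = zeroAnswerOf b

  zeroAnswerOf-cases : ∀ b' → zeroAnswerOf b' ≡ dai ⊎ zeroAnswerOf b' ≡ act pos ⟦ al 0 ⟧ []
  zeroAnswerOf-cases true = inj₂ refl
  zeroAnswerOf-cases false = inj₁ refl

  zeroAnswer-cases : zeroAnswer ≡ dai ⊎ zeroAnswer ≡ act pos ⟦ al 0 ⟧ []
  zeroAnswer-cases = zeroAnswerOf-cases b

  zeroAnswer-pos : polA zeroAnswer ≡ pos
  zeroAnswer-pos with zeroAnswer-cases
  ... | inj₁ h = cong polA h
  ... | inj₂ h = cong polA h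

  -- Nodes of the tree of chronicles of P_b.  root: the empty chronicle; Z, ZX: σ opened with ∅,
  -- then the answer to 0; S j: the spine (σ.i̅ opened with {0} and α.i̅ answered, for i < j);
  -- T j, C j, O j: the round of the spine extending S j to S (j+1); F j, FN j: the end of the
  -- computation after S j when σ.(j+1)̅ is opened with ∅, P then playing (+,α.j̅,∅).
  data Node : Set where
    root Z ZX : Node
    S T C O F FN : ℕ → Node

  round : ℕ → List Action
  round j = act pos ⟦ sg0 j ⟧ (1 ∷ []) ∷ act neg ⟦ sg (suc j) ⟧ (0 ∷ []) ∷
            act pos ⟦ al j ⟧ (0 ∷ []) ∷ act neg ⟦ al0 j ⟧ (1 ∷ []) ∷ []

  chronT chronC chronO chronF : ℕ → List Action
  chronT j = spine σ α j ∷ʳ act pos ⟦ sg0 j ⟧ (1 ∷ [])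
  chronC j = chronT j ∷ʳ act neg ⟦ sg (suc j) ⟧ (0 ∷ [])
  chronO j = chronC j ∷ʳ act pos ⟦ al j ⟧ (0 ∷ [])
  chronF j = chronT j ∷ʳ act neg ⟦ sg (suc j) ⟧ []

  chronOf : Node → List Action
  chronOf root = []
  chronOf Z = act neg σ [] ∷ []
  chronOf ZX = act neg σ [] ∷ zeroAnswer ∷ []
  chronOf (S j) = spine σ α j
  chronOf (T j) = chronT j
  chronOf (C j) = chronC j
  chronOf (O j) = chronO j
  chronOf (F j) = chronF j
  chronOf (FN j) = chronF j ∷ʳ act pos ⟦ al j ⟧ []

  -- the parent of a node (the root is its own parent)
  parent : Node → Node
  parent root = root
  parent Z = root
  parent ZX = Z
  parent (S zero) = root
  parent (S (suc j)) = O j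
  parent (T j) = S j
  parent (C j) = T j
  parent (O j) = C j
  parent (F j) = T j
  parent (FN j) = F j

  lastAct : Node → Action
  lastAct root = dai
  lastAct Z = act neg σ []
  lastAct ZX = zeroAnswer
  lastAct (S zero) = act neg σ (0 ∷ [])
  lastAct (S (suc j)) = act neg ⟦ al0 j ⟧ (1 ∷ [])
  lastAct (T j) = act pos ⟦ sg0 j ⟧ (1 ∷ [])
  lastAct (C j) = act neg ⟦ sg (suc j) ⟧ (0 ∷ [])
  lastAct (O j) = act pos ⟦ al j ⟧ (0 ∷ [])
  lastAct (F j) = act neg ⟦ sg (suc j) ⟧ []
  lastAct (FN j) = act pos ⟦ al j ⟧ []

  snoc4 : ∀ (w : List Action) a b' c' d → w ++ (a ∷ b' ∷ c' ∷ d ∷ []) ≡ (((w ∷ʳ a) ∷ʳ b') ∷ʳ c') ∷ʳ d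
  snoc4 [] a b' c' d = refl
  snoc4 (x ∷ w) a b' c' d = cong (x ∷_) (snoc4 w a b' c' d)

  spine-suc : ∀ j → spine σ α (suc j) ≡ chronOf (O j) ∷ʳ act neg ⟦ al0 j ⟧ (1 ∷ [])
  spine-suc j = snoc4 (spine σ α j) _ _ _ _

  chron-parent : ∀ st → st ≢ root → chronOf st ≡ chronOf (parent st) ∷ʳ lastAct st
  chron-parent root ne = ⊥-elim (ne refl)
  chron-parent Z ne = refl
  chron-parent ZX ne = refl
  chron-parent (S zero) ne = refl
  chron-parent (S (suc j)) ne = spine-suc j
  chron-parent (T j) ne = refl
  chron-parent (C j) ne = refl
  chron-parent (O j) ne = refl
  chron-parent (F j) ne = refl
  chron-parent (FN j) ne = refl

  root? : ∀ st → st ≡ root ⊎ st ≢ root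
  root? root = inj₁ refl
  root? Z = inj₂ (λ ())
  root? ZX = inj₂ (λ ())
  root? (S _) = inj₂ (λ ())
  root? (T _) = inj₂ (λ ())
  root? (C _) = inj₂ (λ ())
  root? (O _) = inj₂ (λ ())
  root? (F _) = inj₂ (λ ())
  root? (FN _) = inj₂ (λ ())

  -- Induction on nodes along the parent relation (by the length of their chronicles).
  node-ind : (P : Node → Set) → P root → (∀ st → st ≢ root → P (parent st) → P st) → ∀ st → P st
  node-ind P base step st = go (length (chronOf st)) st NP.≤-refl
    where
    go : ∀ n st → length (chronOf st) ≤ n → P st
    go n st h with root? st
    ... | inj₁ refl = base
    go zero st h | inj₂ ne with chronOf st | chron-parent st ne
    ... | .(chronOf (parent st) ∷ʳ lastAct st) | refl = ⊥-elim (NP.≤⇒≯ h (subst (0 <_) (sym (len-snoc (chronOf (parent st)) (lastAct st))) (s≤s z≤n)))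
    go (suc n) st h | inj₂ ne = step st ne (go n (parent st)
        (NP.≤-pred (NP.≤-trans (NP.≤-reflexive (sym (len-snoc (chronOf (parent st)) (lastAct st))))
                     (NP.≤-trans (NP.≤-reflexive (cong length (sym (chron-parent st ne)))) h))))

  children : Node → List Node
  children root = Z ∷ S 0 ∷ []
  children Z = ZX ∷ []
  children ZX = []
  children (S j) = T j ∷ []
  children (T j) = C j ∷ F j ∷ []
  children (C j) = O j ∷ []
  children (O j) = S (suc j) ∷ []
  children (F j) = FN j ∷ []
  children (FN j) = []

  child-of-parent : ∀ st → st ≢ root → st ∈ children (parent st)
  child-of-parent root ne = ⊥-elim (ne refl)
  child-of-parent Z ne = here refl
  child-of-parent ZX ne = here refl
  child-of-parent (S zero) ne = there (here refl)
  child-of-parent (S (suc j)) ne = here refl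
  child-of-parent (T j) ne = here refl
  child-of-parent (C j) ne = here refl
  child-of-parent (O j) ne = here refl
  child-of-parent (F j) ne = there (here refl)
  child-of-parent (FN j) ne = here refl

  children-inj : ∀ st a a' → a ∈ children st → a' ∈ children st → lastAct a ≡ lastAct a' → a ≡ a'
  children-inj root .Z .Z (here refl) (here refl) h = refl
  children-inj root .Z .(S 0) (here refl) (there (here refl)) ()
  children-inj root .(S 0) .Z (there (here refl)) (here refl) ()
  children-inj root .(S 0) .(S 0) (there (here refl)) (there (here refl)) h = refl
  children-inj Z .ZX .ZX (here refl) (here refl) h = refl
  children-inj (S j) .(T j) .(T j) (here refl) (here refl) h = refl
  children-inj (T j) .(C j) .(C j) (here refl) (here refl) h = refl
  children-inj (T j) .(C j) .(F j) (here refl) (there (here refl)) ()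
  children-inj (T j) .(F j) .(C j) (there (here refl)) (here refl) ()
  children-inj (T j) .(F j) .(F j) (there (here refl)) (there (here refl)) h = refl
  children-inj (C j) .(O j) .(O j) (here refl) (here refl) h = refl
  children-inj (O j) .(S (suc j)) .(S (suc j)) (here refl) (here refl) h = refl
  children-inj (F j) .(FN j) .(FN j) (here refl) (here refl) h = refl

  -- Distinct children of a node are reached by negative actions on the same locus: the tree
  -- only branches on the opponent's moves, as required of a design.
  children-branch : ∀ st a a' → a ∈ children st → a' ∈ children st → lastAct a ≢ lastAct a' →
    polA (lastAct a) ≡ neg × polA (lastAct a') ≡ neg × focus (lastAct a) ≡ focus (lastAct a')
  children-branch root .Z .Z (here refl) (here refl) h = ⊥-elim (h refl)
  children-branch root .Z .(S 0) (here refl) (there (here refl)) h = refl , refl , refl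
  children-branch root .(S 0) .Z (there (here refl)) (here refl) h = refl , refl , refl
  children-branch root .(S 0) .(S 0) (there (here refl)) (there (here refl)) h = ⊥-elim (h refl)
  children-branch Z .ZX .ZX (here refl) (here refl) h = ⊥-elim (h refl)
  children-branch (S j) .(T j) .(T j) (here refl) (here refl) h = ⊥-elim (h refl)
  children-branch (T j) .(C j) .(C j) (here refl) (here refl) h = ⊥-elim (h refl)
  children-branch (T j) .(C j) .(F j) (here refl) (there (here refl)) h = refl , refl , refl
  children-branch (T j) .(F j) .(C j) (there (here refl)) (here refl) h = refl , refl , refl
  children-branch (T j) .(F j) .(F j) (there (here refl)) (there (here refl)) h = ⊥-elim (h refl)
  children-branch (C j) .(O j) .(O j) (here refl) (here refl) h = ⊥-elim (h refl)
  children-branch (O j) .(S (suc j)) .(S (suc j)) (here refl) (here refl) h = ⊥-elim (h refl)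
  children-branch (F j) .(FN j) .(FN j) (here refl) (here refl) h = ⊥-elim (h refl)

  chron-inj : ∀ a a' → chronOf a ≡ chronOf a' → a ≡ a'
  chron-inj = node-ind (λ a → ∀ a' → chronOf a ≡ chronOf a' → a ≡ a') base step
    where
    base : ∀ a' → [] ≡ chronOf a' → root ≡ a'
    base a' h with root? a'
    ... | inj₁ refl = refl
    ... | inj₂ ne = ⊥-elim (snoc≢[] _ _ (trans (sym (chron-parent a' ne)) (sym h)))
    step : ∀ a → a ≢ root → (∀ a' → chronOf (parent a) ≡ chronOf a' → parent a ≡ a') → ∀ a' → chronOf a ≡ chronOf a' → a ≡ a'
    step a ne ih a' h with root? a'
    ... | inj₁ refl = ⊥-elim (snoc≢[] _ _ (trans (sym (chron-parent a ne)) h))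
    ... | inj₂ ne' with snoc-inj (trans (sym (chron-parent a ne)) (trans h (chron-parent a' ne')))
    ... | h1 , h2 with ih (parent a') h1
    ... | pe = children-inj (parent a) a a' (child-of-parent a ne) (subst (λ q → a' ∈ children q) (sym pe) (child-of-parent a' ne')) h2

  prefix-chron : ∀ st c r → c ++ r ≡ chronOf st → ∃[ st' ] (c ≡ chronOf st')
  prefix-chron = node-ind (λ st → ∀ c r → c ++ r ≡ chronOf st → ∃[ st' ] (c ≡ chronOf st')) base step
    where
    base : ∀ c r → c ++ r ≡ [] → ∃[ st' ] (c ≡ chronOf st')
    base c r h = root , LP.++-conicalˡ c r h
    step : ∀ st → st ≢ root → (∀ c r → c ++ r ≡ chronOf (parent st) → ∃[ st' ] (c ≡ chronOf st')) →
           ∀ c r → c ++ r ≡ chronOf st → ∃[ st' ] (c ≡ chronOf st')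
    step st ne ih c r h with snoc-view r
    ... | inj₁ refl = st , trans (sym (LP.++-identityʳ c)) h
    ... | inj₂ (r' , y , refl) =
      ih c r' (proj₁ (snoc-inj {xs = c ++ r'} (trans (LP.++-assoc c r' [ y ]) (trans h (chron-parent st ne)))))

  prefix-chron-ne : ∀ st c r → c ≢ [] → c ++ r ≡ chronOf st → ∃[ st' ] (st' ≢ root × c ≡ chronOf st')
  prefix-chron-ne st c r ne h with prefix-chron st c r h
  ... | st' , eq with root? st'
  ... | inj₁ refl = ⊥-elim (ne eq)
  ... | inj₂ ne' = st' , ne' , eq

  foci-∈⁻ : ∀ s' {ζ} → ζ ∈ foci s' → ∃[ p ] ∃[ I ] (act p ζ I ∈ s')
  foci-∈⁻ [] ()
  foci-∈⁻ (dai ∷ s') m with foci-∈⁻ s' m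
  ... | p , I , m' = p , I , there m'
  foci-∈⁻ (act p ζ I ∷ s') (here refl) = p , I , here refl
  foci-∈⁻ (act p ζ I ∷ s') (there m) with foci-∈⁻ s' m
  ... | p' , I' , m' = p' , I' , there m'

  spine-mem⁻ : ∀ j {κ} → κ ∈ spine σ α j → κ ≡ act neg ⟦ sg 0 ⟧ (0 ∷ []) ⊎ ∃[ i ] (i < j × κ ∈ round i)
  spine-mem⁻ zero (here refl) = inj₁ refl
  spine-mem⁻ (suc j) m with ∈-++⁻ (spine σ α j) m
  ... | inj₂ m' = inj₂ (j , NP.≤-refl , m')
  ... | inj₁ m' with spine-mem⁻ j m'
  ... | inj₁ h = inj₁ h
  ... | inj₂ (i , i<j , m'') = inj₂ (i , NP.m≤n⇒m≤1+n i<j , m'')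

  spine-mem⁺ : ∀ j {i κ} → i < j → κ ∈ round i → κ ∈ spine σ α j
  spine-mem⁺ (suc j) {i} i<j m with i ≟ j
  ... | yes refl = ∈-++⁺ʳ (spine σ α j) m
  ... | no i≢j = ∈-++⁺ˡ (spine-mem⁺ j (NP.≤∧≢⇒< (NP.≤-pred i<j) i≢j) m)

  spine-σ : ∀ j → act neg ⟦ sg 0 ⟧ (0 ∷ []) ∈ spine σ α j
  spine-σ zero = here refl
  spine-σ (suc j) = ∈-++⁺ˡ (spine-σ j)

  spine-sgj : ∀ j → act neg ⟦ sg j ⟧ (0 ∷ []) ∈ spine σ α j
  spine-sgj zero = here refl
  spine-sgj (suc j) = spine-mem⁺ (suc j) NP.≤-refl (there (here refl))

  spine-last : ∀ j → act neg ⟦ al0 j ⟧ (1 ∷ []) ∈ spine σ α (suc j)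
  spine-last j = spine-mem⁺ (suc j) NP.≤-refl (there (there (there (here refl))))

  SpineCode : ℕ → Code → Set
  SpineCode j cd = cd ≡ sg 0 ⊎ ∃[ i ] (i < j × (cd ≡ sg0 i ⊎ cd ≡ sg (suc i) ⊎ cd ≡ al i ⊎ cd ≡ al0 i))

  foci-spine : ∀ j {ζ} → ζ ∈ foci (spine σ α j) → ∃[ cd ] (ζ ≡ ⟦ cd ⟧ × SpineCode j cd)
  foci-spine j m with foci-∈⁻ (spine σ α j) m
  ... | p , I , m' with spine-mem⁻ j m'
  ... | inj₁ refl = sg 0 , refl , inj₁ refl
  ... | inj₂ (i , i<j , here refl) = sg0 i , refl , inj₂ (i , i<j , inj₁ refl)
  ... | inj₂ (i , i<j , there (here refl)) = sg (suc i) , refl , inj₂ (i , i<j , inj₂ (inj₁ refl))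
  ... | inj₂ (i , i<j , there (there (here refl))) = al i , refl , inj₂ (i , i<j , inj₂ (inj₂ (inj₁ refl)))
  ... | inj₂ (i , i<j , there (there (there (here refl)))) = al0 i , refl , inj₂ (i , i<j , inj₂ (inj₂ (inj₂ refl)))

  foci-snoc⁻ : ∀ s' p ξ I {ζ} → ζ ∈ foci (s' ∷ʳ act p ξ I) → ζ ∈ foci s' ⊎ ζ ≡ ξ
  foci-snoc⁻ s' p ξ I m with ∈-++⁻ (foci s') (subst (_ ∈_) (foci-++ s' _) m)
  ... | inj₁ m' = inj₁ m'
  ... | inj₂ (here h) = inj₂ h

  ¬spine-sg0 : ∀ j → ¬ SpineCode j (sg0 j)
  ¬spine-sg0 j (inj₁ ())
  ¬spine-sg0 j (inj₂ (i , i<j , inj₁ refl)) = NP.<-irrefl refl i<j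
  ¬spine-sg0 j (inj₂ (i , i<j , inj₂ (inj₁ ())))
  ¬spine-sg0 j (inj₂ (i , i<j , inj₂ (inj₂ (inj₁ ()))))
  ¬spine-sg0 j (inj₂ (i , i<j , inj₂ (inj₂ (inj₂ ()))))

  ¬spine-sgs : ∀ j → ¬ SpineCode j (sg (suc j))
  ¬spine-sgs j (inj₁ ())
  ¬spine-sgs j (inj₂ (i , i<j , inj₁ ()))
  ¬spine-sgs j (inj₂ (i , i<j , inj₂ (inj₁ refl))) = NP.<-irrefl refl i<j
  ¬spine-sgs j (inj₂ (i , i<j , inj₂ (inj₂ (inj₁ ()))))
  ¬spine-sgs j (inj₂ (i , i<j , inj₂ (inj₂ (inj₂ ()))))

  ¬spine-al : ∀ j → ¬ SpineCode j (al j)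
  ¬spine-al j (inj₁ ())
  ¬spine-al j (inj₂ (i , i<j , inj₁ ()))
  ¬spine-al j (inj₂ (i , i<j , inj₂ (inj₁ ())))
  ¬spine-al j (inj₂ (i , i<j , inj₂ (inj₂ (inj₁ refl)))) = NP.<-irrefl refl i<j
  ¬spine-al j (inj₂ (i , i<j , inj₂ (inj₂ (inj₂ ()))))

  ¬spine-al0 : ∀ j → ¬ SpineCode j (al0 j)
  ¬spine-al0 j (inj₁ ())
  ¬spine-al0 j (inj₂ (i , i<j , inj₁ ()))
  ¬spine-al0 j (inj₂ (i , i<j , inj₂ (inj₁ ())))
  ¬spine-al0 j (inj₂ (i , i<j , inj₂ (inj₂ (inj₁ ()))))
  ¬spine-al0 j (inj₂ (i , i<j , inj₂ (inj₂ (inj₂ refl)))) = NP.<-irrefl refl i<j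

  notin-spine : ∀ j cd → ¬ SpineCode j cd → ⟦ cd ⟧ ∉ foci (spine σ α j)
  notin-spine j cd n m with foci-spine j m
  ... | cd' , eq , sp = n (subst (SpineCode j) (sym (⟦⟧-inj cd cd' eq)) sp)

  notin-snoc : ∀ s' p ξ I {ζ} → ζ ∉ foci s' → ζ ≢ ξ → ζ ∉ foci (s' ∷ʳ act p ξ I)
  notin-snoc s' p ξ I n ne m with foci-snoc⁻ s' p ξ I m
  ... | inj₁ m' = n m'
  ... | inj₂ h = ne h

  code-neq : ∀ a a' → a ≢ a' → ⟦ a ⟧ ≢ ⟦ a' ⟧
  code-neq a a' n h = n (⟦⟧-inj a a' h)

  fresh-T : ∀ j c → ¬ SpineCode j c → c ≢ sg0 j → ⟦ c ⟧ ∉ foci (chronT j)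
  fresh-T j c ns n0 = notin-snoc (spine σ α j) pos ⟦ sg0 j ⟧ _ (notin-spine j c ns) (code-neq c (sg0 j) n0)

  fresh-C : ∀ j c → ¬ SpineCode j c → c ≢ sg0 j → c ≢ sg (suc j) → ⟦ c ⟧ ∉ foci (chronC j)
  fresh-C j c ns n0 n1 = notin-snoc (chronT j) neg ⟦ sg (suc j) ⟧ _ (fresh-T j c ns n0) (code-neq c (sg (suc j)) n1)

  fresh-F : ∀ j c → ¬ SpineCode j c → c ≢ sg0 j → c ≢ sg (suc j) → ⟦ c ⟧ ∉ foci (chronF j)
  fresh-F j c ns n0 n1 = notin-snoc (chronT j) neg ⟦ sg (suc j) ⟧ _ (fresh-T j c ns n0) (code-neq c (sg (suc j)) n1)

  fresh-O : ∀ j c → ¬ SpineCode j c → c ≢ sg0 j → c ≢ sg (suc j) → c ≢ al j → ⟦ c ⟧ ∉ foci (chronO j)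
  fresh-O j c ns n0 n1 n2 = notin-snoc (chronC j) pos ⟦ al j ⟧ _ (fresh-C j c ns n0 n1) (code-neq c (al j) n2)

  GoodSelfView : Node → Set
  GoodSelfView st = Good baseP (chronOf st) × SelfView baseP (chronOf st)

  chron≢[] : ∀ st → st ≢ root → chronOf st ≢ []
  chron≢[] st ne h = snoc≢[] _ _ (trans (sym (chron-parent st ne)) h)

  alt-next : ∀ st κ → st ≢ root → Alt neg (chronOf st) → polA κ ≡ flip (polA (lastAct st)) → Alt neg (chronOf st ∷ʳ κ)
  alt-next st κ ne a h = subst (λ q → Alt neg (q ∷ʳ κ)) (sym (chron-parent st ne))
    (alt-snoc2 (chronOf (parent st)) (lastAct st) κ (subst (Alt neg) (chron-parent st ne) a) h)

  polS : ∀ j → polA (lastAct (S j)) ≡ neg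
  polS zero = refl
  polS (suc j) = refl

  ram0 : AllPairs _<_ (0 ∷ [])
  ram0 = [] ∷ []
  ram1 : AllPairs _<_ (1 ∷ [])
  ram1 = [] ∷ []

  goodView-S : ∀ j → GoodSelfView (S j)
  goodView-T : ∀ j → GoodSelfView (T j)
  goodView-C : ∀ j → GoodSelfView (C j)
  goodView-O : ∀ j → GoodSelfView (O j)
  goodView-F : ∀ j → GoodSelfView (F j)
  goodView-FN : ∀ j → GoodSelfView (FN j)

  goodView-S zero = good-snoc [] neg σ (0 ∷ []) good[] (alt-one refl) (inj₁ refl) (λ ()) ram0 , svInit refl
  goodView-S (suc j) with goodView-O j
  ... | G , I =
    subst GI' (sym (spine-suc j))
      (good-snoc (chronO j) neg ⟦ al0 j ⟧ (1 ∷ []) G (alt-next (O j) _ (λ ()) (galt G) refl)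
         (inj₂ (⟦ al j ⟧ , 0 ∷ [] , 0 , ∈-++⁺ʳ (chronC j) (here refl) , here refl , refl))
         (fresh-O j (al0 j) (¬spine-al0 j) (λ ()) (λ ()) (λ ()))
         ram1 ,
       svJust (here refl) refl I)
    where GI' = λ q → Good baseP q × SelfView baseP q
  goodView-T j with goodView-S j
  ... | G , I = good-snoc (spine σ α j) pos ⟦ sg0 j ⟧ (1 ∷ []) G
                  (alt-next (S j) _ (λ ()) (galt G) (sym (cong flip (polS j))))
                  (inj₂ (⟦ sg j ⟧ , 0 ∷ [] , 0 , spine-sgj j , here refl , refl))
                  (notin-spine j _ (¬spine-sg0 j)) ram1 ,
                svPos refl (inj₂ (chron≢[] (S j) (λ ()))) I
  goodView-C j with goodView-T j
  ... | G , I = good-snoc (chronT j) neg ⟦ sg (suc j) ⟧ (0 ∷ []) G (alt-next (T j) _ (λ ()) (galt G) refl)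
                  (inj₂ (⟦ sg0 j ⟧ , 1 ∷ [] , 1 , ∈-++⁺ʳ (spine σ α j) (here refl) , here refl , refl))
                  (fresh-T j (sg (suc j)) (¬spine-sgs j) (λ ())) ram0 ,
                svJust (here refl) refl I
  goodView-F j with goodView-T j
  ... | G , I = good-snoc (chronT j) neg ⟦ sg (suc j) ⟧ [] G (alt-next (T j) _ (λ ()) (galt G) refl)
                  (inj₂ (⟦ sg0 j ⟧ , 1 ∷ [] , 1 , ∈-++⁺ʳ (spine σ α j) (here refl) , here refl , refl))
                  (fresh-T j (sg (suc j)) (¬spine-sgs j) (λ ())) [] ,
                svJust (here refl) refl I
  goodView-O j with goodView-C j
  ... | G , I = good-snoc (chronC j) pos ⟦ al j ⟧ (0 ∷ []) G (alt-next (C j) _ (λ ()) (galt G) refl)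
                  (jal j)
                  (fresh-C j (al j) (¬spine-al j) (λ ()) (λ ())) ram0 ,
                svPos refl (inj₂ (chron≢[] (C j) (λ ()))) I
    where
    jal : ∀ j → JustifiedBy baseP (chronC j) pos ⟦ al j ⟧
    jal zero = inj₁ (here refl)
    jal (suc j) = inj₂ (⟦ al0 j ⟧ , 1 ∷ [] , 1 , ∈-++⁺ˡ (∈-++⁺ˡ (spine-last j)) , here refl , refl)
  goodView-FN j with goodView-F j
  ... | G , I = good-snoc (chronF j) pos ⟦ al j ⟧ [] G (alt-next (F j) _ (λ ()) (galt G) refl)
                  (jal j)
                  (fresh-F j (al j) (¬spine-al j) (λ ()) (λ ())) [] ,
                svPos refl (inj₂ (chron≢[] (F j) (λ ()))) I
    where
    jal : ∀ j → JustifiedBy baseP (chronF j) pos ⟦ al j ⟧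
    jal zero = inj₁ (here refl)
    jal (suc j) = inj₂ (⟦ al0 j ⟧ , 1 ∷ [] , 1 , ∈-++⁺ˡ (∈-++⁺ˡ (spine-last j)) , here refl , refl)

  goodView-Z : GoodSelfView Z
  goodView-Z = good-snoc [] neg σ [] good[] (alt-one refl) (inj₁ refl) (λ ()) [] , svInit refl

  selfView-prefix : ∀ {B} s' t' → SelfView B (s' ++ t') → SelfView B s'
  selfView-prefix s' [] h = subst (SelfView _) (LP.++-identityʳ s') h
  selfView-prefix s' (y ∷ t') h = selfView-init (selfView-prefix (s' ∷ʳ y) t' (subst (SelfView _) (sym (LP.++-assoc s' [ y ] t')) h)) refl

  legal-chron : ∀ st → st ≢ root → Legal baseP (chronOf st)
  sv-chron : ∀ st → st ≢ root → SelfView baseP (chronOf st)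
  legal-chron root ne = ⊥-elim (ne refl)
  legal-chron Z ne = good→legal (proj₁ goodView-Z)
  legal-chron ZX ne = lz zeroAnswer zeroAnswer-cases
    where
    lz : ∀ x → x ≡ dai ⊎ x ≡ act pos ⟦ al 0 ⟧ [] → Legal baseP (act neg σ [] ∷ x ∷ [])
    lz .(act pos α []) (inj₂ refl) =
      good→legal (good-snoc (act neg σ [] ∷ []) pos α [] (proj₁ goodView-Z) (alt∷ refl (alt∷ refl alt[]))
                   (inj₁ (here refl)) α-fresh [])
      where
      α-fresh : α ∉ σ ∷ []
      α-fresh (here h) = proj₁ dis ([] , trans (LP.++-identityʳ σ) (sym h))
    lz .dai (inj₁ refl) = legal-dai (proj₁ goodView-Z) (alt∷ refl (alt∷ refl alt[]))
  legal-chron (S j) ne = good→legal (proj₁ (goodView-S j))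
  legal-chron (T j) ne = good→legal (proj₁ (goodView-T j))
  legal-chron (C j) ne = good→legal (proj₁ (goodView-C j))
  legal-chron (O j) ne = good→legal (proj₁ (goodView-O j))
  legal-chron (F j) ne = good→legal (proj₁ (goodView-F j))
  legal-chron (FN j) ne = good→legal (proj₁ (goodView-FN j))
  sv-chron root ne = ⊥-elim (ne refl)
  sv-chron Z ne = proj₂ goodView-Z
  sv-chron ZX ne = svPos zeroAnswer-pos (inj₂ (λ ())) (proj₂ goodView-Z)
  sv-chron (S j) ne = proj₂ (goodView-S j)
  sv-chron (T j) ne = proj₂ (goodView-T j)
  sv-chron (C j) ne = proj₂ (goodView-C j)
  sv-chron (O j) ne = proj₂ (goodView-O j)
  sv-chron (F j) ne = proj₂ (goodView-F j)
  sv-chron (FN j) ne = proj₂ (goodView-FN j)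

  immjust : ∀ {B} s' → SelfView B s' → ImmJust s'
  immjust s' h w κ ζ J r eq with selfView-neg (selfView-prefix ((w ∷ʳ κ) ∷ʳ act neg ζ J) r (subst (SelfView _) (trans eq (sym lem)) h)) refl
    where
    lem : ((w ∷ʳ κ) ∷ʳ act neg ζ J) ++ r ≡ w ++ (κ ∷ act neg ζ J ∷ r)
    lem = trans (LP.++-assoc (w ∷ʳ κ) _ r) (LP.++-assoc w [ κ ] _)
  ... | inj₁ h' = ⊥-elim (snoc≢[] w κ h')
  ... | inj₂ (s'' , ξ' , I' , i' , teq , m , ee) = ξ' , I' , i' , proj₂ (snoc-inj teq) , m , ee

  -- The design P_b.  For b = false this is literally the predecessor P of the statement.
  PredB : DSet
  PredB c' = PrefixOf c' (act neg σ [] ∷ zeroAnswer ∷ []) ⊎ ∃[ k ] PrefixOf c' (pEnd σ α k)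

  pEnd≡ : ∀ k → pEnd σ α k ≡ chronOf (FN k)
  pEnd≡ k = snoc3 (spine σ α k) _ _ _
    where
    snoc3 : ∀ (w : List Action) a b' c' → w ++ (a ∷ b' ∷ c' ∷ []) ≡ ((w ∷ʳ a) ∷ʳ b') ∷ʳ c'
    snoc3 [] a b' c' = refl
    snoc3 (x ∷ w) a b' c' = cong (x ∷_) (snoc3 w a b' c')

  PredB→node : ∀ c' → PredB c' → ∃[ st ] (st ≢ root × c' ≡ chronOf st)
  PredB→node c' (inj₁ (ne , r , h)) = prefix-chron-ne ZX c' r ne h
  PredB→node c' (inj₂ (k , ne , r , h)) = prefix-chron-ne (FN k) c' r ne (trans h (pEnd≡ k))

  snoc-++ : ∀ (s' : List Action) a R → (s' ∷ʳ a) ++ R ≡ s' ++ (a ∷ R)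
  snoc-++ s' a R = LP.++-assoc s' [ a ] R

  node→PredB : ∀ st → st ≢ root → PredB (chronOf st)
  node→PredB root ne = ⊥-elim (ne refl)
  node→PredB Z ne = inj₁ ((λ ()) , zeroAnswer ∷ [] , refl)
  node→PredB ZX ne = inj₁ ((λ ()) , [] , refl)
  node→PredB (S j) ne = inj₂ (j , chron≢[] (S j) ne , _ , refl)
  node→PredB (T j) ne = inj₂ (j , chron≢[] (T j) ne , _ , snoc-++ (spine σ α j) _ _)
  node→PredB (F j) ne = inj₂ (j , chron≢[] (F j) ne , _ , sym (pEnd≡ j))
  node→PredB (FN j) ne = inj₂ (j , chron≢[] (FN j) ne , [] , trans (LP.++-identityʳ _) (sym (pEnd≡ j)))
  node→PredB (C j) ne = inj₂ (suc j , chron≢[] (C j) ne , _ ,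
    trans (snoc-++ (chronT j) _ _) (trans (snoc-++ (spine σ α j) _ _) (sym (LP.++-assoc (spine σ α j) (round j) _))))
  node→PredB (O j) ne = inj₂ (suc j , chron≢[] (O j) ne , _ ,
    trans (snoc-++ (chronC j) _ _) (trans (snoc-++ (chronT j) _ _) (trans (snoc-++ (spine σ α j) _ _) (sym (LP.++-assoc (spine σ α j) (round j) _)))))

  PredB-arbor : ∀ c₁ c₂ → c₁ ≢ [] → PredB (c₁ ++ c₂) → PredB c₁
  PredB-arbor c₁ c₂ ne (inj₁ (_ , r , h)) = inj₁ (ne , c₂ ++ r , trans (sym (LP.++-assoc c₁ c₂ r)) h)
  PredB-arbor c₁ c₂ ne (inj₂ (k , _ , r , h)) = inj₂ (k , ne , c₂ ++ r , trans (sym (LP.++-assoc c₁ c₂ r)) h)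

  PredB-snoc : ∀ w κ → PredB (w ∷ʳ κ) → ∃[ st ] (st ≢ root × w ≡ chronOf (parent st) × κ ≡ lastAct st)
  PredB-snoc w κ q with PredB→node (w ∷ʳ κ) q
  ... | st , ne , h with snoc-inj (trans h (chron-parent st ne))
  ... | h1 , h2 = st , ne , h1 , h2

  posit-st : ∀ st → st ≢ root → polA (lastAct st) ≡ neg → ∃[ κ' ] PredB (chronOf st ∷ʳ κ')
  posit-st root ne h = ⊥-elim (ne refl)
  posit-st Z ne h = zeroAnswer , node→PredB ZX (λ ())
  posit-st ZX ne h with trans (sym zeroAnswer-pos) h
  ... | ()
  posit-st (S j) ne h = _ , node→PredB (T j) (λ ())
  posit-st (T j) ne ()
  posit-st (C j) ne h = _ , node→PredB (O j) (λ ())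
  posit-st (O j) ne ()
  posit-st (F j) ne h = _ , node→PredB (FN j) (λ ())
  posit-st (FN j) ne ()

  PredB-design : Design baseP PredB
  PredB-design = record
    { chron = λ c' q → let (st , ne , eq) = PredB→node c' q in
        subst (Chronicle baseP) (sym eq) (chron≢[] st ne , legal-chron st ne , immjust (chronOf st) (sv-chron st ne))
    ; arbor = λ c₁ c₂ ne q → PredB-arbor c₁ c₂ ne q
    ; coher = coh
    ; posit = pos'
    ; total = λ ()
    }
    where
    coh : ∀ c₁ c₂ w κ₁ κ₂ r₁ r₂ → PredB c₁ → PredB c₂ →
          c₁ ≡ w ++ (κ₁ ∷ r₁) → c₂ ≡ w ++ (κ₂ ∷ r₂) → κ₁ ≢ κ₂ →
          polA κ₁ ≡ neg × polA κ₂ ≡ neg × (focus κ₁ ≢ focus κ₂ → ∀ ζ → ζ ∈ foci r₁ → ζ ∉ foci r₂)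
    coh c₁ c₂ w κ₁ κ₂ r₁ r₂ q₁ q₂ e₁ e₂ ne
      with PredB-snoc w κ₁ (PredB-arbor (w ∷ʳ κ₁) r₁ (snoc≢[] w κ₁) (subst PredB (trans e₁ (sym (snoc-++ w κ₁ r₁))) q₁))
         | PredB-snoc w κ₂ (PredB-arbor (w ∷ʳ κ₂) r₂ (snoc≢[] w κ₂) (subst PredB (trans e₂ (sym (snoc-++ w κ₂ r₂))) q₂))
    ... | st₁ , ne₁ , w₁ , refl | st₂ , ne₂ , w₂ , refl with chron-inj (parent st₁) (parent st₂) (trans (sym w₁) w₂)
    ... | pe with children-branch (parent st₁) st₁ st₂ (child-of-parent st₁ ne₁) (subst (λ q → st₂ ∈ children q) (sym pe) (child-of-parent st₂ ne₂)) ne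
    ... | p1 , p2 , fe = p1 , p2 , λ h → ⊥-elim (h fe)
    pos' : ∀ w κ → PredB (w ∷ʳ κ) → polA κ ≡ neg → ∃[ κ' ] PredB ((w ∷ʳ κ) ∷ʳ κ')
    pos' w κ q h with PredB→node (w ∷ʳ κ) q
    ... | st , ne , eq with snoc-inj (trans eq (chron-parent st ne))
    ... | _ , refl = subst (λ l → ∃[ κ' ] PredB (l ∷ʳ κ')) (sym eq) (posit-st st ne h)

module Interaction (σ α : Locus) (dis : Disjoint σ α) (b : Bool) where
  open Sequences

  open Loci σ α dis
  open PredTree σ α dis b

  -- the interaction moves underlying a sequence of actions (the daimon is not a move)
  moves : List Action → List Move
  moves [] = []
  moves (dai ∷ l) = moves l
  moves (act p ζ I ∷ l) = (ζ , I) ∷ moves l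

  moves-++ : ∀ l l' → moves (l ++ l') ≡ moves l ++ moves l'
  moves-++ [] l' = refl
  moves-++ (dai ∷ l) l' = moves-++ l l'
  moves-++ (act p ζ I ∷ l) l' = cong ((ζ , I) ∷_) (moves-++ l l')

  proj1 : ∀ B ζ I {p} → locPol B ζ ≡ just p → proj B ((ζ , I) ∷ []) ≡ act p ζ I ∷ []
  proj1 B ζ I e with locPol B ζ
  proj1 B ζ I refl | just _ = refl

  proj0 : ∀ B ζ I → locPol B ζ ≡ nothing → proj B ((ζ , I) ∷ []) ≡ []
  proj0 B ζ I e with locPol B ζ
  proj0 B ζ I refl | nothing = refl

  proj-snoc : ∀ B u m → proj B (u ∷ʳ m) ≡ proj B u ++ proj B [ m ]
  proj-snoc B u m = proj-++ B u [ m ]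

  proj-extend : ∀ B u l ζ I {p} → proj B u ≡ l → locPol B ζ ≡ just p → proj B (u ∷ʳ (ζ , I)) ≡ l ∷ʳ act p ζ I
  proj-extend B u l ζ I e lp = trans (proj-snoc B u (ζ , I)) (cong₂ _++_ e (proj1 B ζ I lp))

  -- the first j rounds of the chronicle of an integer on ξ (what the input plays before
  -- answering at ξ.j̅)
  natPrefix : Locus → ℕ → List Action
  natPrefix ξ zero = []
  natPrefix ξ (suc j) = (natPrefix ξ j ∷ʳ act pos (bar j ξ) (0 ∷ [])) ∷ʳ act neg (bar j ξ · 0) (1 ∷ [])

  bar-shift : ∀ j ξ → bar j ((ξ · 0) · 1) ≡ bar (suc j) ξ
  bar-shift zero ξ = refl
  bar-shift (suc j) ξ = cong (λ q → (q · 0) · 1) (bar-shift j ξ)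

  natChron-split : ∀ ξ j m → natChron ξ (j + m) ≡ natPrefix ξ j ++ natChron (bar j ξ) m
  natChron-split ξ zero m = refl
  natChron-split ξ (suc j) m = trans (cong (natChron ξ) (sym (NP.+-suc j m))) (trans (natChron-split ξ j (suc m))
    (trans (cong (λ q → natPrefix ξ j ++ (act pos (bar j ξ) (0 ∷ []) ∷ act neg (bar j ξ · 0) (1 ∷ []) ∷ natChron q m)) (bar-shift 0 (bar j ξ)))
    (sym (trans (LP.++-assoc (natPrefix ξ j ∷ʳ _) [ _ ] _) (LP.++-assoc (natPrefix ξ j) [ _ ] _)))))

  inputPart : Node → List Action
  inputPart root = []
  inputPart Z = act pos σ [] ∷ []
  inputPart ZX = act pos σ [] ∷ []
  inputPart (S j) = natPrefix σ j ∷ʳ act pos ⟦ sg j ⟧ (0 ∷ [])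
  inputPart (T j) = natPrefix σ (suc j)
  inputPart (C j) = natPrefix σ (suc j) ∷ʳ act pos ⟦ sg (suc j) ⟧ (0 ∷ [])
  inputPart (O j) = natPrefix σ (suc j) ∷ʳ act pos ⟦ sg (suc j) ⟧ (0 ∷ [])
  inputPart (F j) = natPrefix σ (suc j) ∷ʳ act pos ⟦ sg (suc j) ⟧ []
  inputPart (FN j) = natPrefix σ (suc j) ∷ʳ act pos ⟦ sg (suc j) ⟧ []

  outputPart : Node → List Action
  outputPart root = []
  outputPart Z = []
  outputPart ZX = act pos α [] ∷ []
  outputPart (S j) = natPrefix α j
  outputPart (T j) = natPrefix α j
  outputPart (C j) = natPrefix α j
  outputPart (O j) = natPrefix α j ∷ʳ act pos ⟦ al j ⟧ (0 ∷ [])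
  outputPart (F j) = natPrefix α j
  outputPart (FN j) = natPrefix α j ∷ʳ act pos ⟦ al j ⟧ []

  -- the nodes reachable in an interaction with the input n
  Admissible : ℕ → Node → Set
  Admissible n root = ⊤
  Admissible n Z = n ≡ 0
  Admissible n ZX = n ≡ 0 × zeroAnswer ≡ act pos α []
  Admissible n (S j) = j < n
  Admissible n (T j) = j < n
  Admissible n (C j) = suc j < n
  Admissible n (O j) = suc j < n
  Admissible n (F j) = suc j ≡ n
  Admissible n (FN j) = suc j ≡ n

  Projects : Node → Set
  Projects st = proj baseP (moves (chronOf st)) ≡ chronOf st × proj baseIn (moves (chronOf st)) ≡ inputPart st × proj baseOut (moves (chronOf st)) ≡ outputPart st

  proj-step : ∀ B st → st ≢ root → proj B (moves (chronOf st)) ≡ proj B (moves (chronOf (parent st))) ++ proj B (moves [ lastAct st ])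
  proj-step B st ne = trans (cong (λ q → proj B (moves q)) (chron-parent st ne))
    (trans (cong (proj B) (moves-++ (chronOf (parent st)) [ lastAct st ])) (proj-++ B (moves (chronOf (parent st))) (moves [ lastAct st ])))

  projects-step : ∀ st → st ≢ root → Projects (parent st) →
    proj baseP (moves [ lastAct st ]) ≡ [ lastAct st ] →
    inputPart st ≡ inputPart (parent st) ++ proj baseIn (moves [ lastAct st ]) →
    outputPart st ≡ outputPart (parent st) ++ proj baseOut (moves [ lastAct st ]) → Projects st
  projects-step st ne (h1 , h2 , h3) q1 q2 q3 =
    trans (proj-step baseP st ne) (trans (cong₂ _++_ h1 q1) (sym (chron-parent st ne))) ,
    trans (proj-step baseIn st ne) (trans (cong (_++ proj baseIn (moves [ lastAct st ])) h2) (sym q2)) ,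
    trans (proj-step baseOut st ne) (trans (cong (_++ proj baseOut (moves [ lastAct st ])) h3) (sym q3))

  ++[] : ∀ (l : List Action) → l ≡ l ++ []
  ++[] l = sym (LP.++-identityʳ l)

  projects : ∀ st → st ≢ ZX → Projects st
  projects = node-ind (λ st → st ≢ ZX → Projects st) (λ _ → refl , refl , refl) step
    where
    step : ∀ st → st ≢ root → (parent st ≢ ZX → Projects (parent st)) → st ≢ ZX → Projects st
    step root ne ih nz = ⊥-elim (ne refl)
    step Z ne ih nz = projects-step Z ne (ih λ ()) (proj1 baseP σ [] (polP (sg 0))) (sym (proj1 baseIn σ [] (polIn-sg 0))) (sym (proj0 baseOut σ [] (polOut-sg 0)))
    step ZX ne ih nz = ⊥-elim (nz refl)
    step (S zero) ne ih nz = projects-step (S 0) ne (ih λ ()) (proj1 baseP σ _ (polP (sg 0))) (sym (proj1 baseIn σ _ (polIn-sg 0))) (sym (proj0 baseOut σ _ (polOut-sg 0)))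
    step (S (suc j)) ne ih nz = projects-step (S (suc j)) ne (ih λ ()) (proj1 baseP _ _ (polP (al0 j)))
      (trans (++[] _) (cong (inputPart (O j) ++_) (sym (proj0 baseIn _ (1 ∷ []) (polIn-al0 j)))))
      (cong (natPrefix α j ∷ʳ act pos ⟦ al j ⟧ (0 ∷ []) ++_) (sym (proj1 baseOut _ (1 ∷ []) (polOut-al0 j))))
    step (T j) ne ih nz = projects-step (T j) ne (ih λ ()) (proj1 baseP _ _ (polP (sg0 j)))
      (cong (inputPart (S j) ++_) (sym (proj1 baseIn _ (1 ∷ []) (polIn-sg0 j))))
      (trans (++[] _) (cong (outputPart (S j) ++_) (sym (proj0 baseOut _ (1 ∷ []) (polOut-sg0 j)))))
    step (C j) ne ih nz = projects-step (C j) ne (ih λ ()) (proj1 baseP _ _ (polP (sg (suc j))))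
      (cong (inputPart (T j) ++_) (sym (proj1 baseIn _ (0 ∷ []) (polIn-sg (suc j)))))
      (trans (++[] _) (cong (outputPart (T j) ++_) (sym (proj0 baseOut _ (0 ∷ []) (polOut-sg (suc j))))))
    step (O j) ne ih nz = projects-step (O j) ne (ih λ ()) (proj1 baseP _ _ (polP (al j)))
      (trans (++[] _) (cong (inputPart (C j) ++_) (sym (proj0 baseIn _ (0 ∷ []) (polIn-al j)))))
      (cong (outputPart (C j) ++_) (sym (proj1 baseOut _ (0 ∷ []) (polOut-al j))))
    step (F j) ne ih nz = projects-step (F j) ne (ih λ ()) (proj1 baseP _ _ (polP (sg (suc j))))
      (cong (inputPart (T j) ++_) (sym (proj1 baseIn _ [] (polIn-sg (suc j)))))
      (trans (++[] _) (cong (outputPart (T j) ++_) (sym (proj0 baseOut _ [] (polOut-sg (suc j))))))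
    step (FN j) ne ih nz = projects-step (FN j) ne (ih λ ()) (proj1 baseP _ _ (polP (al j)))
      (trans (++[] _) (cong (inputPart (F j) ++_) (sym (proj0 baseIn _ [] (polIn-al j)))))
      (cong (outputPart (F j) ++_) (sym (proj1 baseOut _ [] (polOut-al j))))

  projects-ZX : zeroAnswer ≡ act pos α [] → Projects ZX
  projects-ZX h = go zeroAnswer h
    where
    go : ∀ x → x ≡ act pos α [] →
      proj baseP (moves (act neg σ [] ∷ x ∷ [])) ≡ act neg σ [] ∷ x ∷ [] ×
      proj baseIn (moves (act neg σ [] ∷ x ∷ [])) ≡ act pos σ [] ∷ [] ×
      proj baseOut (moves (act neg σ [] ∷ x ∷ [])) ≡ act pos α [] ∷ []
    go .(act pos α []) refl =
      trans (proj-++ baseP [ (σ , []) ] [ (α , []) ]) (cong₂ _++_ (proj1 baseP σ [] (polP (sg 0))) (proj1 baseP α [] (polP (al 0)))) ,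
      trans (proj-++ baseIn [ (σ , []) ] [ (α , []) ]) (cong₂ _++_ (proj1 baseIn σ [] (polIn-sg 0)) (proj0 baseIn α [] (polIn-al 0))) ,
      trans (proj-++ baseOut [ (σ , []) ] [ (α , []) ]) (cong₂ _++_ (proj0 baseOut σ [] (polOut-sg 0)) (proj1 baseOut α [] (polOut-al 0)))

  spine-closed : ∀ j ξ I' i → act pos ξ I' ∈ spine σ α j → i ∈ I' → ξ · i ∈ foci (spine σ α j)
  spine-closed j ξ I' i m im with spine-mem⁻ j m
  ... | inj₁ ()
  ... | inj₂ (i' , i'<j , here refl) with im
  ...   | here refl = foci-∈ (spine-mem⁺ j i'<j (there (here refl)))
  ...   | there ()
  spine-closed j ξ I' i m im | inj₂ (i' , i'<j , there (here ()))
  spine-closed j ξ I' i m im | inj₂ (i' , i'<j , there (there (here refl))) with im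
  ...   | here refl = foci-∈ (spine-mem⁺ j i'<j (there (there (there (here refl)))))
  ...   | there ()
  spine-closed j ξ I' i m im | inj₂ (i' , i'<j , there (there (there (here ()))))
  spine-closed j ξ I' i m im | inj₂ (i' , i'<j , there (there (there (there ()))))

  foci-pre : ∀ l l' {ζ} → ζ ∈ foci l → ζ ∈ foci (l ++ l')
  foci-pre l l' {ζ} m = subst (ζ ∈_) (sym (foci-++ l l')) (∈-++⁺ˡ m)

  σ∈spine : ∀ j → σ ∈ foci (spine σ α j)
  σ∈spine j = foci-∈ (spine-σ j)

  JustifiedP : List Action → Locus → Set
  JustifiedP l ζ = JustifiedBy baseP l neg ζ

  next-root : ∀ {ζ} → JustifiedP [] ζ → ζ ≡ σ
  next-root (inj₁ refl) = refl
  next-root (inj₂ (_ , _ , _ , () , _))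

  mem-snoc⁻ : ∀ {A : Set} (l : List A) y {x} → x ∈ l ∷ʳ y → x ∈ l ⊎ x ≡ y
  mem-snoc⁻ l y m with ∈-++⁻ l m
  ... | inj₁ m' = inj₁ m'
  ... | inj₂ (here h) = inj₂ h

  upO : ∀ {j ζ} → ζ ∈ foci (chronT j) → ζ ∈ foci (chronO j)
  upO {j} m = foci-pre (chronC j) _ (foci-pre (chronT j) _ m)

  upF : ∀ {j ζ} → ζ ∈ foci (chronT j) → ζ ∈ foci (chronOf (FN j))
  upF {j} m = foci-pre (chronF j) _ (foci-pre (chronT j) _ m)

  next-T : ∀ j {ζ} → JustifiedP (chronT j) ζ → ζ ∉ foci (chronT j) → ζ ≡ ⟦ sg (suc j) ⟧
  next-T j (inj₁ refl) nf = ⊥-elim (nf (foci-pre (spine σ α j) _ (σ∈spine j)))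
  next-T j (inj₂ (ξ , I' , i , m , im , refl)) nf with mem-snoc⁻ (spine σ α j) _ m
  ... | inj₁ m' = ⊥-elim (nf (foci-pre (spine σ α j) _ (spine-closed j ξ I' i m' im)))
  ... | inj₂ refl with im
  ...   | here refl = refl
  ...   | there ()

  next-O : ∀ j {ζ} → JustifiedP (chronO j) ζ → ζ ∉ foci (chronO j) → ζ ≡ ⟦ al0 j ⟧
  next-O j (inj₁ refl) nf = ⊥-elim (nf (upO {j} (foci-pre (spine σ α j) _ (σ∈spine j))))
  next-O j (inj₂ (ξ , I' , i , m , im , refl)) nf with mem-snoc⁻ (chronC j) _ m
  ... | inj₂ refl with im
  ...   | here refl = refl
  ...   | there ()
  next-O j (inj₂ (ξ , I' , i , m , im , refl)) nf | inj₁ m' with mem-snoc⁻ (chronT j) _ m'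
  ... | inj₂ ()
  ... | inj₁ m'' with mem-snoc⁻ (spine σ α j) _ m''
  ...   | inj₁ m3 = ⊥-elim (nf (upO {j} (foci-pre (spine σ α j) _ (spine-closed j ξ I' i m3 im))))
  ...   | inj₂ refl with im
  ...     | here refl = ⊥-elim (nf (foci-pre (chronC j) _ (subst (_ ∈_) (sym (foci-++ (chronT j) _)) (∈-++⁺ʳ (foci (chronT j)) (here refl)))))
  ...     | there ()

  no-next-FN : ∀ j {ζ} → JustifiedP (chronOf (FN j)) ζ → ζ ∉ foci (chronOf (FN j)) → ⊥
  no-next-FN j (inj₁ refl) nf = nf (upF {j} (foci-pre (spine σ α j) _ (σ∈spine j)))
  no-next-FN j (inj₂ (ξ , I' , i , m , im , refl)) nf with mem-snoc⁻ (chronF j) _ m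
  ... | inj₂ refl with im
  ...   | ()
  no-next-FN j (inj₂ (ξ , I' , i , m , im , refl)) nf | inj₁ m' with mem-snoc⁻ (chronT j) _ m'
  ... | inj₂ ()
  ... | inj₁ m'' with mem-snoc⁻ (spine σ α j) _ m''
  ...   | inj₁ m3 = nf (upF {j} (foci-pre (spine σ α j) _ (spine-closed j ξ I' i m3 im)))
  ...   | inj₂ refl with im
  ...     | here refl = nf (foci-pre (chronF j) _ (subst (_ ∈_) (sym (foci-++ (chronT j) _)) (∈-++⁺ʳ (foci (chronT j)) (here refl))))
  ...     | there ()

  no-next-ZX : ∀ {ζ} → JustifiedP (act neg σ [] ∷ act pos α [] ∷ []) ζ → ζ ∉ foci (act neg σ [] ∷ act pos α [] ∷ []) → ⊥
  no-next-ZX (inj₁ refl) nf = nf (here refl)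
  no-next-ZX (inj₂ (ξ , I' , i , here () , im , refl)) nf
  no-next-ZX (inj₂ (ξ , .[] , i , there (here refl) , () , refl)) nf
  no-next-ZX (inj₂ (ξ , I' , i , there (there ()) , im , refl)) nf

  sv-natPrefix : ∀ ξ j → SelfView ⊢[ ξ ] (natPrefix ξ j)
  sv-natPrefix ξ zero = sv[]
  sv-natPrefix ξ (suc j) = svJust (here refl) refl (svPos refl (inj₁ refl) (sv-natPrefix ξ j))

  sv-natPrefix⁺ : ∀ ξ j I → SelfView ⊢[ ξ ] (natPrefix ξ j ∷ʳ act pos (bar j ξ) I)
  sv-natPrefix⁺ ξ j I = svPos refl (inj₁ refl) (sv-natPrefix ξ j)

  sv-inputPart : ∀ st → SelfView baseIn (inputPart st)
  sv-inputPart root = sv[]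
  sv-inputPart Z = svPos refl (inj₁ refl) sv[]
  sv-inputPart ZX = svPos refl (inj₁ refl) sv[]
  sv-inputPart (S j) = sv-natPrefix⁺ σ j _
  sv-inputPart (T j) = sv-natPrefix σ (suc j)
  sv-inputPart (C j) = sv-natPrefix⁺ σ (suc j) _
  sv-inputPart (O j) = sv-natPrefix⁺ σ (suc j) _
  sv-inputPart (F j) = sv-natPrefix⁺ σ (suc j) _
  sv-inputPart (FN j) = sv-natPrefix⁺ σ (suc j) _

  lt-split : ∀ {j n} → j < n → ∃[ m ] (n ≡ suc (j + m))
  lt-split {j} {n} h with NP.m≤n⇒∃[o]m+o≡n h
  ... | m , e = m , sym e

  nat-first : ∀ n I → natD σ n (act pos σ I ∷ []) → (n ≡ 0 × I ≡ []) ⊎ (∃[ n' ] (n ≡ suc n') × I ≡ 0 ∷ [])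
  nat-first zero I (_ , r , refl) = inj₁ (refl , refl)
  nat-first (suc n) I (_ , r , refl) = inj₂ (n , refl , refl)

  nat-T : ∀ j m I → natD σ (suc (j + m)) (natPrefix σ (suc j) ∷ʳ act pos ⟦ sg (suc j) ⟧ I) →
    (m ≡ 0 × I ≡ []) ⊎ (∃[ m' ] (m ≡ suc m') × I ≡ 0 ∷ [])
  nat-T j m I (_ , r , h) with LP.++-cancelˡ (natPrefix σ (suc j)) _ _ (trans (sym (LP.++-assoc (natPrefix σ (suc j)) _ r)) (trans h (natChron-split σ (suc j) m)))
  nat-T j zero I (_ , r , h) | refl = inj₁ (refl , refl)
  nat-T j (suc m) I (_ , r , h) | refl = inj₂ (m , refl , refl)

  view-PredB : ∀ l κ → SelfView baseP l → l ≢ [] → polA κ ≡ pos → Play baseP PredB (l ∷ʳ κ) → PredB (l ∷ʳ κ)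
  view-PredB l κ isl ne pk pl' = proj₂ pl' l κ [] (sym (LP.++-identityʳ _)) pk (l ∷ʳ κ) (view-self (svPos pk (inj₂ ne) isl))

  viewN : ∀ n l κ → SelfView baseIn l → polA κ ≡ pos → Play baseIn (natD σ n) (l ∷ʳ κ) → natD σ n (l ∷ʳ κ)
  viewN n l κ isl pk pl' = proj₂ pl' l κ [] (sym (LP.++-identityʳ _)) pk (l ∷ʳ κ) (view-self (svPos pk (inj₁ refl) isl))

  player-move : ∀ st κ → st ≢ root → polA κ ≡ pos → Play baseP PredB (chronOf st ∷ʳ κ) → ∃[ st'' ] (st'' ∈ children st × lastAct st'' ≡ κ)
  player-move st κ ne pk pp with PredB-snoc (chronOf st) κ (view-PredB (chronOf st) κ (sv-chron st ne) (chron≢[] st ne) pk pp)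
  ... | st'' , ne'' , w , k with chron-inj st (parent st'') w
  ... | refl = st'' , child-of-parent st'' ne'' , sym k

  alt-P : ∀ {D} st κ → st ≢ root → Play baseP D (chronOf st ∷ʳ κ) → polA κ ≡ flip (polA (lastAct st))
  alt-P st κ ne pp = alt-snoc2⁻ (chronOf (parent st)) (lastAct st) κ (subst (λ q → Alt neg (q ∷ʳ κ)) (chron-parent st ne) (proj₁ (proj₁ pp)))

  justified-P : ∀ {D} l ζ I → Play baseP D (l ∷ʳ act neg ζ I) → JustifiedP l ζ
  justified-P l ζ I pp = just-snoc⁻ l neg ζ I (proj₁ (proj₂ (proj₂ (proj₁ pp))))

  fresh-P : ∀ {D} l p ζ I → Play baseP D (l ∷ʳ act p ζ I) → ζ ∉ foci l
  fresh-P l p ζ I pp = uniq-foci-snoc⁻ l p ζ I (proj₁ (proj₂ (proj₂ (proj₂ (proj₁ pp)))))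

  isJust-witness : ∀ {A : Set} (mx : Maybe A) → TT (is-just mx) → ∃[ x ] (mx ≡ just x)
  isJust-witness (just x) _ = x , refl

  predNetB : ℕ → Net
  predNetB n = (baseP , PredB) ∷ (baseIn , natD σ n) ∷ []

  -- The invariant: an interaction of {P_b, n} is the chronicle of an admissible node, or a dead
  -- end where, at O j, α.j̅.0 was opened with a ramification other than {1}.
  Reachable : ℕ → List Move → Set
  Reachable n u = (∃[ st ] (Admissible n st × u ≡ moves (chronOf st))) ⊎
            (∃[ j ] ∃[ I ] (suc j < n × I ≢ (1 ∷ []) × u ≡ moves (chronO j) ∷ʳ (⟦ al0 j ⟧ , I)))

  locPol-P : ∀ n ζ → AnyN (predNetB n) (λ d → TT (is-just (locPol (proj₁ d) ζ))) → ∃[ p ] (locPol baseP ζ ≡ just p)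
  locPol-P n ζ (inj₁ h) = isJust-witness _ h
  locPol-P n ζ (inj₂ (inj₁ h)) with isJust-witness _ h
  ... | q , e = flip q , in→P ζ e
  locPol-P n ζ (inj₂ (inj₂ ()))

  projects-admissible : ∀ n st → Admissible n st → Projects st
  projects-admissible n root _ = projects root (λ ())
  projects-admissible n Z _ = projects Z (λ ())
  projects-admissible n ZX (_ , h) = projects-ZX h
  projects-admissible n (S j) _ = projects (S j) (λ ())
  projects-admissible n (T j) _ = projects (T j) (λ ())
  projects-admissible n (C j) _ = projects (C j) (λ ())
  projects-admissible n (O j) _ = projects (O j) (λ ())
  projects-admissible n (F j) _ = projects (F j) (λ ())
  projects-admissible n (FN j) _ = projects (FN j) (λ ())

  StepFrom : ℕ → Node → Set
  StepFrom n st = ∀ p ζ I → locPol baseP ζ ≡ just p →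
     Play baseP PredB (chronOf st ∷ʳ act p ζ I) → Play baseIn (natD σ n) (inputPart st ++ proj baseIn [ (ζ , I) ]) →
     Reachable n (moves (chronOf st) ∷ʳ (ζ , I))

  player-step : ∀ n st → Admissible n st → polA (lastAct st) ≡ neg → StepFrom n st
  player-step n root _ ()
  player-step n Z ok _ p ζ I lp pp pn with alt-P Z (act p ζ I) (λ ()) pp
  ... | refl with player-move Z (act pos ζ I) (λ ()) refl pp
  ... | .ZX , here refl , k with zeroAnswer-cases
  ... | inj₁ xd with trans (sym xd) k
  ...   | ()
  player-step n Z ok _ p ζ I lp pp pn | refl | .ZX , here refl , k | inj₂ xa with trans (sym xa) k
  ... | refl = inj₁ (ZX , (ok , xa) , cong (λ x → moves (act neg σ [] ∷ x ∷ [])) (sym xa))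
  player-step n ZX _ e with trans (sym zeroAnswer-pos) e
  ... | ()
  player-step n (S j) ok _ p ζ I lp pp pn with trans (alt-P (S j) (act p ζ I) (λ ()) pp) (cong flip (polS j))
  ... | refl with player-move (S j) (act pos ζ I) (λ ()) refl pp
  ... | .(T j) , here refl , refl = inj₁ (T j , ok , sym (moves-++ (spine σ α j) _))
  player-step n (T j) _ ()
  player-step n (C j) ok _ p ζ I lp pp pn with alt-P (C j) (act p ζ I) (λ ()) pp
  ... | refl with player-move (C j) (act pos ζ I) (λ ()) refl pp
  ... | .(O j) , here refl , refl = inj₁ (O j , ok , sym (moves-++ (chronC j) _))
  player-step n (O j) _ ()
  player-step n (F j) ok _ p ζ I lp pp pn with alt-P (F j) (act p ζ I) (λ ()) pp
  ... | refl with player-move (F j) (act pos ζ I) (λ ()) refl pp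
  ... | .(FN j) , here refl , refl = inj₁ (FN j , ok , sym (moves-++ (chronF j) _))
  player-step n (FN j) _ ()

  -- After a positive action (or at the start), the opponent moves: the next action opens the
  -- unique free negative locus of P's chronicle, with a ramification chosen by the input n
  -- (at T j) or by nobody (at O j, where any ramification other than {1} is a dead end).
  opponent-step : ∀ n st → Admissible n st → polA (lastAct st) ≡ pos → StepFrom n st
  opponent-step n root _ _ p ζ I lp pp pn with alt-head (proj₁ (proj₁ pp))
  ... | refl with next-root (justified-P [] ζ I pp)
  ... | refl with nat-first n I (viewN n [] (act pos σ I) sv[] refl (subst (Play baseIn (natD σ n)) (proj1 baseIn σ I (polIn-sg 0)) pn))
  ... | inj₁ (refl , refl) = inj₁ (Z , refl , refl)
  ... | inj₂ (n' , refl , refl) = inj₁ (S 0 , s≤s z≤n , refl)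
  opponent-step n Z _ ()
  opponent-step n ZX (ok , xa) _ p ζ I lp pp pn with trans (alt-P ZX (act p ζ I) (λ ()) pp) (cong flip zeroAnswer-pos)
  ... | refl = ⊥-elim (no-next-ZX (subst (λ l → JustifiedP l ζ) e (justified-P (chronOf ZX) ζ I pp))
                                   (subst (λ l → ζ ∉ foci l) e (fresh-P (chronOf ZX) neg ζ I pp)))
    where e = cong (λ x → act neg σ [] ∷ x ∷ []) xa
  opponent-step n (S zero) _ ()
  opponent-step n (S (suc j)) _ ()
  opponent-step n (T j) ok _ p ζ I lp pp pn with alt-P (T j) (act p ζ I) (λ ()) pp
  ... | refl with next-T j (justified-P (chronT j) ζ I pp) (fresh-P (chronT j) neg ζ I pp)
  ... | refl with lt-split ok
  ... | m , refl with nat-T j m I (viewN n (natPrefix σ (suc j)) _ (sv-natPrefix σ (suc j)) refl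
                        (subst (Play baseIn (natD σ n)) (cong (natPrefix σ (suc j) ++_) (proj1 baseIn _ I (polIn-sg (suc j)))) pn))
  ... | inj₁ (refl , refl) = inj₁ (F j , cong suc (sym (NP.+-identityʳ j)) , sym (moves-++ (chronT j) _))
  ... | inj₂ (m' , refl , refl) =
    inj₁ (C j , s≤s (subst (suc j ≤_) (sym (NP.+-suc j m')) (s≤s (NP.m≤m+n j m'))) , sym (moves-++ (chronT j) _))
  opponent-step n (C j) _ ()
  opponent-step n (O j) ok _ p ζ I lp pp pn with alt-P (O j) (act p ζ I) (λ ()) pp
  ... | refl with next-O j (justified-P (chronO j) ζ I pp) (fresh-P (chronO j) neg ζ I pp)
  ... | refl with LP.≡-dec NP._≟_ I (1 ∷ [])
  ... | yes refl = inj₁ (S (suc j) , ok , sym (trans (cong moves (spine-suc j)) (moves-++ (chronO j) _)))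
  ... | no ne = inj₂ (j , I , ok , ne , refl)
  opponent-step n (F j) _ ()
  opponent-step n (FN j) ok _ p ζ I lp pp pn with alt-P (FN j) (act p ζ I) (λ ()) pp
  ... | refl = ⊥-elim (no-next-FN j (justified-P (chronOf (FN j)) ζ I pp) (fresh-P (chronOf (FN j)) neg ζ I pp))

  step-from-node : ∀ n st → Admissible n st → StepFrom n st
  step-from-node n st ok with polA (lastAct st) in e
  ... | pos = opponent-step n st ok e
  ... | neg = player-step n st ok e

  dead∉PredB : ∀ j I₀ → I₀ ≢ (1 ∷ []) → ¬ PredB (chronO j ∷ʳ act neg ⟦ al0 j ⟧ I₀)
  dead∉PredB j I₀ ne q with PredB-snoc (chronO j) (act neg ⟦ al0 j ⟧ I₀) q
  ... | st'' , ne'' , w , k with chron-inj (O j) (parent st'') w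
  ... | pe with subst (λ q' → st'' ∈ children q') (sym pe) (child-of-parent st'' ne'')
  ... | here refl with k
  ... | refl = ne refl

  sv-dead : ∀ j I₀ → SelfView baseP (chronO j ∷ʳ act neg ⟦ al0 j ⟧ I₀)
  sv-dead j I₀ = svJust (here refl) refl (sv-chron (O j) (λ ()))

  step-from-dead : ∀ j I₀ → I₀ ≢ (1 ∷ []) → ∀ p ζ I → ¬ Play baseP PredB ((chronO j ∷ʳ act neg ⟦ al0 j ⟧ I₀) ∷ʳ act p ζ I)
  step-from-dead j I₀ ne p ζ I pp with alt-snoc2⁻ (chronO j) (act neg ⟦ al0 j ⟧ I₀) (act p ζ I) (proj₁ (proj₁ pp))
  ... | refl = dead∉PredB j I₀ ne (PredB-arbor _ [ act pos ζ I ] (snoc≢[] (chronO j) _)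
                  (view-PredB _ (act pos ζ I) (sv-dead j I₀) (snoc≢[] (chronO j) _) refl pp))

  projects-dead : ∀ j I₀ → proj baseP (moves (chronO j) ∷ʳ (⟦ al0 j ⟧ , I₀)) ≡ chronO j ∷ʳ act neg ⟦ al0 j ⟧ I₀
  projects-dead j I₀ = proj-extend baseP (moves (chronO j)) _ _ I₀ (proj₁ (projects (O j) (λ ()))) (polP (al0 j))

  step : ∀ n u m → Reachable n u → IntSeq (predNetB n) (u ∷ʳ m) → Reachable n (u ∷ʳ m)
  step n u (ζ , I) reachable (hs , ppP , ppN , tt) with AllP.++⁻ʳ u hs
  ... | h ∷ [] with locPol-P n ζ h
  ... | p , lp with reachable
  ... | inj₁ (st , ok , refl) =
    step-from-node n st ok p ζ I lp
      (subst (Play baseP PredB) (proj-extend baseP (moves (chronOf st)) _ ζ I (proj₁ prj) lp) ppP)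
      (subst (Play baseIn (natD σ n)) (trans (proj-snoc baseIn (moves (chronOf st)) (ζ , I)) (cong (_++ _) (proj₁ (proj₂ prj)))) ppN)
    where prj = projects-admissible n st ok
  ... | inj₂ (j , I₀ , ok , ne , refl) =
    ⊥-elim (step-from-dead j I₀ ne p ζ I (subst (Play baseP PredB) (proj-extend baseP (moves (chronO j) ∷ʳ (⟦ al0 j ⟧ , I₀)) _ ζ I (projects-dead j I₀) lp) ppP))

  reachable : ∀ n u → IntSeq (predNetB n) u → Reachable n u
  reachable n u is = go [] u (inj₁ (root , tt , refl)) is
    where
    go : ∀ acc rest → Reachable n acc → IntSeq (predNetB n) (acc ++ rest) → Reachable n (acc ++ rest)
    go acc [] iv is' = subst (Reachable n) (sym (LP.++-identityʳ acc)) iv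
    go acc (m ∷ rest) iv is' =
      let is2 = subst (IntSeq (predNetB n)) (sym (LP.++-assoc acc [ m ] rest)) is'
      in subst (Reachable n) (LP.++-assoc acc [ m ] rest)
           (go (acc ∷ʳ m) rest (step n acc m iv (intseq-prefix (predNetB n) (acc ∷ʳ m) rest is2)) is2)

module NormalForm (σ α : Locus) (dis : Disjoint σ α) (b : Bool) where
  open Sequences

  open Loci σ α dis
  open PredTree σ α dis b
  open Interaction σ α dis b

  barξ-inj : ∀ ξ i j → bar i ξ ≡ bar j ξ → i ≡ j
  barξ-inj ξ i j h = bar-inj i j (LP.++-cancelˡ ξ _ _ (trans (sym (bar-app i ξ)) (trans h (bar-app j ξ))))

  bar0ξ≢ : ∀ ξ i j → bar i ξ · 0 ≢ bar j ξ
  bar0ξ≢ ξ i j h = bar0≢ i j (LP.++-cancelˡ ξ _ _ (trans (sym (split0 i ξ)) (trans h (bar-app j ξ))))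

  natPrefix-mem : ∀ ξ j {p ζ I} → act p ζ I ∈ natPrefix ξ j → ∃[ i ] (i < j × (ζ ≡ bar i ξ ⊎ ζ ≡ bar i ξ · 0))
  natPrefix-mem ξ zero ()
  natPrefix-mem ξ (suc j) m with mem-snoc⁻ (natPrefix ξ j ∷ʳ _) _ m
  ... | inj₂ refl = j , NP.≤-refl , inj₂ refl
  ... | inj₁ m' with mem-snoc⁻ (natPrefix ξ j) _ m'
  ... | inj₂ refl = j , NP.≤-refl , inj₁ refl
  ... | inj₁ m'' with natPrefix-mem ξ j m''
  ... | i , i<j , h = i , NP.m≤n⇒m≤1+n i<j , h

  foci-natPrefix : ∀ ξ j {ζ} → ζ ∈ foci (natPrefix ξ j) → ∃[ i ] (i < j × (ζ ≡ bar i ξ ⊎ ζ ≡ bar i ξ · 0))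
  foci-natPrefix ξ j m with foci-∈⁻ (natPrefix ξ j) m
  ... | p , I , m' = natPrefix-mem ξ j m'

  natPrefix-fresh : ∀ ξ j → bar j ξ ∉ foci (natPrefix ξ j)
  natPrefix-fresh ξ j m with foci-natPrefix ξ j m
  ... | i , i<j , inj₁ h = NP.<-irrefl (barξ-inj ξ i j (sym h)) i<j
  ... | i , i<j , inj₂ h = bar0ξ≢ ξ i j (sym h)

  natPrefix-fresh0 : ∀ ξ j → bar j ξ · 0 ∉ foci (natPrefix ξ j)
  natPrefix-fresh0 ξ j m with foci-natPrefix ξ j m
  ... | i , i<j , inj₁ h = bar0ξ≢ ξ j i h
  ... | i , i<j , inj₂ h = NP.<-irrefl (barξ-inj ξ i j (sym (proj₁ (snoc-inj h)))) i<j

  good-natPrefix : ∀ ξ j → Good ⊢[ ξ ] (natPrefix ξ j)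
  good-natPrefix⁺ : ∀ ξ j I → AllPairs _<_ I → Good ⊢[ ξ ] (natPrefix ξ j ∷ʳ act pos (bar j ξ) I)
  good-natPrefix ξ zero = good[]
  good-natPrefix ξ (suc j) =
    let G = good-natPrefix⁺ ξ j (0 ∷ []) ([] ∷ []) in
    good-snoc (natPrefix ξ j ∷ʳ act pos (bar j ξ) (0 ∷ [])) neg (bar j ξ · 0) (1 ∷ []) G
      (alt-snoc2 (natPrefix ξ j) _ _ (galt G) refl)
      (inj₂ (bar j ξ , 0 ∷ [] , 0 , ∈-++⁺ʳ (natPrefix ξ j) (here refl) , here refl , refl))
      (notin-snoc (natPrefix ξ j) pos (bar j ξ) (0 ∷ []) (natPrefix-fresh0 ξ j) (bar0ξ≢ ξ j j)) ([] ∷ [])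
  good-natPrefix⁺ ξ j I ram = good-snoc (natPrefix ξ j) pos (bar j ξ) I (good-natPrefix ξ j) (alt j) (jb j) (natPrefix-fresh ξ j) ram
    where
    alt : ∀ j → Alt pos (natPrefix ξ j ∷ʳ act pos (bar j ξ) I)
    alt zero = alt-one refl
    alt (suc j) = alt-snoc2 (natPrefix ξ j ∷ʳ _) _ _ (galt (good-natPrefix ξ (suc j))) refl
    jb : ∀ j → JustifiedBy ⊢[ ξ ] (natPrefix ξ j) pos (bar j ξ)
    jb zero = inj₁ (here refl)
    jb (suc j) = inj₂ (bar j ξ · 0 , 1 ∷ [] , 1 , ∈-++⁺ʳ (natPrefix ξ j ∷ʳ _) (here refl) , here refl , refl)

  play-from : ∀ {B} {D : DSet} s' → Legal B s' → SelfView B s' → (∀ t r → t ≢ [] → t ++ r ≡ s' → D t) → Play B D s'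
  play-from s' L isl h = L , λ w κ r eq pk v vw →
    let is' = selfView-prefix (w ∷ʳ κ) r (subst (SelfView _) eq isl)
        u' = uniq-foci-prefix (w ∷ʳ κ) r (subst (λ q → Unique (foci q)) eq (proj₁ (proj₂ (proj₂ (proj₂ L)))))
    in subst _ (sym (view-unique vw is' u')) (h (w ∷ʳ κ) r (snoc≢[] w κ) (sym eq))

  playP-st : ∀ st → st ≢ root → Play baseP PredB (chronOf st)
  playP-st st ne = play-from (chronOf st) (legal-chron st ne) (sv-chron st ne)
    (λ t r tn h → PredB-arbor t r tn (subst PredB (sym h) (node→PredB st ne)))

  natD-pre : ∀ ξ n l r → l ++ r ≡ natChron ξ n → ∀ t r' → t ≢ [] → t ++ r' ≡ l → natD ξ n t
  natD-pre ξ n l r h t r' tn h' = tn , r' ++ r , trans (sym (LP.++-assoc t r' r)) (trans (cong (_++ r) h') h)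

  playN-full : ∀ ξ j I → AllPairs _<_ I → ∀ {n} r → (natPrefix ξ j ∷ʳ act pos (bar j ξ) I) ++ r ≡ natChron ξ n →
    Play ⊢[ ξ ] (natD ξ n) (natPrefix ξ j ∷ʳ act pos (bar j ξ) I)
  playN-full ξ j I ram {n} r h = play-from _ (good→legal (good-natPrefix⁺ ξ j I ram)) (sv-natPrefix⁺ ξ j I) (natD-pre ξ n _ r h)

  natChron-full : ∀ ξ j → natChron ξ j ≡ natPrefix ξ j ∷ʳ act pos (bar j ξ) []
  natChron-full ξ j = trans (cong (natChron ξ) (sym (NP.+-identityʳ j))) (natChron-split ξ j 0)

  proj-len≤ : ∀ B u → length (proj B u) ≤ length u
  proj-len≤ B [] = z≤n
  proj-len≤ B ((ζ , I) ∷ u) with locPol B ζ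
  ... | just _ = s≤s (proj-len≤ B u)
  ... | nothing = NP.m≤n⇒m≤1+n (proj-len≤ B u)

  hered : ∀ B u → length (proj B u) ≡ length u → All (λ m → TT (is-just (locPol B (proj₁ m)))) u
  hered B [] h = []
  hered B ((ζ , I) ∷ u) h with locPol B ζ in eq
  ... | just _ = subst (λ q → TT (is-just q)) (sym eq) tt ∷ hered B u (NP.suc-injective h)
  ... | nothing = ⊥-elim (NP.≤⇒≯ (proj-len≤ B u) (NP.≤-reflexive (sym h)))

  moves-length : ∀ l → NoDai l → length (moves l) ≡ length l
  moves-length [] _ = refl
  moves-length (dai ∷ l) (nd ∷ _) = ⊥-elim (nd refl)
  moves-length (act p ζ I ∷ l) (_ ∷ nd) = cong suc (moves-length l nd)

  intseq-full : ∀ n st → Projects st → NoDai (chronOf st) → Play baseP PredB (chronOf st) → Play baseIn (natD σ n) (inputPart st) →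
    IntSeq (predNetB n) (moves (chronOf st))
  intseq-full n st (h1 , h2 , h3) nd pp pn =
    All.map inj₁ (hered baseP (moves (chronOf st)) (trans (cong length h1) (sym (moves-length (chronOf st) nd)))) ,
    subst (Play baseP PredB) (sym h1) pp , subst (Play baseIn (natD σ n)) (sym h2) pn , tt

  natPrefix-ends-neg : ∀ ξ j w κ → natPrefix ξ j ≡ w ∷ʳ κ → polA κ ≡ neg
  natPrefix-ends-neg ξ zero w κ h = ⊥-elim (snoc≢[] w κ (sym h))
  natPrefix-ends-neg ξ (suc j) w κ h = cong polA (sym (proj₂ (snoc-inj {xs = natPrefix ξ j ∷ʳ _} {ys = w} h)))

  nat-nodai : ∀ ξ n → dai ∉ natChron ξ n
  nat-nodai ξ zero (here ())
  nat-nodai ξ zero (there ())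
  nat-nodai ξ (suc n) (here ())
  nat-nodai ξ (suc n) (there (here ()))
  nat-nodai ξ (suc n) (there (there m)) = nat-nodai _ n m

  natD-nodai : ∀ ξ n l → ¬ natD ξ n (l ∷ʳ dai)
  natD-nodai ξ n l (_ , r , h) = nat-nodai ξ n (subst (dai ∈_) h (∈-++⁺ˡ (∈-++⁺ʳ l (here refl))))

  unique-single : ∀ x → Unique (foci (x ∷ []))
  unique-single dai = []
  unique-single (act p ζ I) = [] ∷ []

  -- the nodes where P has just played a positive action on α, i.e. its output chronicle is positive
  data OutputNode : Node → Set where
    ZX-out : OutputNode ZX
    O-out  : ∀ j → OutputNode (O j)
    FN-out : ∀ j → OutputNode (FN j)

  -- An interaction whose output ends with a positive action stopped at an output node
  -- (a dead end ends with a negative action on α, and the other nodes have negative output).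
  positive-output-node : ∀ n u → IntSeq (predNetB n) u → ∀ w κ → proj baseOut u ≡ w ∷ʳ κ → polA κ ≡ pos →
    ∃[ st ] (OutputNode st × Admissible n st × u ≡ moves (chronOf st))
  positive-output-node n u is w κ eq pk with reachable n u is
  ... | inj₂ (j , I₀ , ok , ne , refl) with trans (sym eq) (trans (proj-snoc baseOut (moves (chronO j)) _)
          (cong₂ _++_ (proj₂ (proj₂ (projects (O j) (λ ())))) (proj1 baseOut _ I₀ (polOut-al0 j))))
  ... | e' with proj₂ (snoc-inj {xs = w} e')
  ... | refl with pk
  ... | ()
  positive-output-node n u is w κ eq pk | inj₁ (st , ok , refl) =
    st , classify st (trans (sym (proj₂ (proj₂ (projects-admissible n st ok)))) eq) , ok , refl
    where
    classify : ∀ st → outputPart st ≡ w ∷ʳ κ → OutputNode st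
    classify root h = ⊥-elim (snoc≢[] w κ (sym h))
    classify Z h = ⊥-elim (snoc≢[] w κ (sym h))
    classify ZX h = ZX-out
    classify (S j) h with trans (sym pk) (natPrefix-ends-neg α j w κ h)
    ... | ()
    classify (T j) h with trans (sym pk) (natPrefix-ends-neg α j w κ h)
    ... | ()
    classify (C j) h with trans (sym pk) (natPrefix-ends-neg α j w κ h)
    ... | ()
    classify (O j) h = O-out j
    classify (F j) h with trans (sym pk) (natPrefix-ends-neg α j w κ h)
    ... | ()
    classify (FN j) h = FN-out j

  output-view : ∀ n u st → Admissible n st → u ≡ moves (chronOf st) → ∀ {v} →
    View baseOut (proj baseOut u) v → View baseOut (outputPart st) v
  output-view n u st ok refl {v} = subst (λ q → View baseOut q v) (proj₂ (proj₂ (projects-admissible n st ok)))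

  positive-outcome : ∀ n u → IntSeq (predNetB n) u → ∀ w κ → proj baseOut u ≡ w ∷ʳ κ → polA κ ≡ pos →
    ∀ v → View baseOut (proj baseOut u) v →
    (∃[ r' ] (v ++ r' ≡ natChron α (n ∸ 1))) × (1 ≤ n ⊎ zeroAnswer ≡ act pos α [])
  positive-outcome n u is w κ eq pk v vw with positive-output-node n u is w κ eq pk
  ... | st , out , ok , e = outcome out ok (output-view n u st ok e vw)
    where
    outcome : ∀ {st} → OutputNode st → Admissible n st → View baseOut (outputPart st) v →
      (∃[ r' ] (v ++ r' ≡ natChron α (n ∸ 1))) × (1 ≤ n ⊎ zeroAnswer ≡ act pos α [])
    outcome ZX-out (refl , xa) vw' with view-unique vw' (sv-natPrefix⁺ α 0 []) (unique-single (act pos α []))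
    ... | refl = ([] , refl) , inj₂ xa
    outcome (O-out j) ok vw' with view-unique vw' (sv-natPrefix⁺ α j (0 ∷ [])) (guniq (good-natPrefix⁺ α j (0 ∷ []) ram0))
    ... | refl with lt-split ok
    ... | m , refl = (_ , trans (LP.++-assoc (natPrefix α j) _ _)
                           (sym (trans (cong (natChron α) (sym (NP.+-suc j m))) (natChron-split α j (suc m))))) ,
                     inj₁ (s≤s z≤n)
    outcome (FN-out j) refl vw' with view-unique vw' (sv-natPrefix⁺ α j []) (guniq (good-natPrefix⁺ α j [] []))
    ... | refl = ([] , trans (LP.++-identityʳ _) (sym (natChron-full α j))) , inj₁ (s≤s z≤n)

  dai-only-at-ZX : ∀ st → st ≢ root → dai ≡ lastAct st → st ≡ ZX × zeroAnswer ≡ dai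
  dai-only-at-ZX root ne h = ⊥-elim (ne refl)
  dai-only-at-ZX Z ne ()
  dai-only-at-ZX ZX ne h = refl , sym h
  dai-only-at-ZX (S zero) ne ()
  dai-only-at-ZX (S (suc j)) ne ()
  dai-only-at-ZX (T j) ne ()
  dai-only-at-ZX (C j) ne ()
  dai-only-at-ZX (O j) ne ()
  dai-only-at-ZX (F j) ne ()
  dai-only-at-ZX (FN j) ne ()

  daimon-outcome : ∀ n u → IntSeq (predNetB n) u →
    AnyN (predNetB n) (λ d → Play (proj₁ d) (proj₂ d) (proj (proj₁ d) u ∷ʳ dai)) → proj baseOut u ≡ [] × n ≡ 0 × zeroAnswer ≡ dai
  daimon-outcome n u is any with reachable n u is
  daimon-outcome n u is (inj₂ (inj₂ ())) | _
  daimon-outcome n u is (inj₂ (inj₁ pn)) | inj₁ (st , ok , refl) =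
    ⊥-elim (natD-nodai σ n (inputPart st) (viewN n (inputPart st) dai (sv-inputPart st) refl
      (subst (λ q → Play baseIn (natD σ n) (q ∷ʳ dai)) (proj₁ (proj₂ (projects-admissible n st ok))) pn)))
  daimon-outcome n u is (inj₂ (inj₁ pn)) | inj₂ (j , I₀ , ok , ne , refl) =
    ⊥-elim (natD-nodai σ n (inputPart (O j)) (viewN n (inputPart (O j)) dai (sv-inputPart (O j)) refl
      (subst (λ q → Play baseIn (natD σ n) (q ∷ʳ dai)) eqn pn)))
    where
    eqn : proj baseIn (moves (chronO j) ∷ʳ (⟦ al0 j ⟧ , I₀)) ≡ inputPart (O j)
    eqn = trans (proj-snoc baseIn (moves (chronO j)) _) (trans (cong₂ _++_ (proj₁ (proj₂ (projects (O j) (λ ())))) (proj0 baseIn _ I₀ (polIn-al0 j))) (LP.++-identityʳ _))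
  daimon-outcome n u is (inj₁ pp) | inj₂ (j , I₀ , ok , ne , refl) =
    ⊥-elim (dead∉PredB j I₀ ne (PredB-arbor _ [ dai ] (snoc≢[] (chronO j) _)
      (view-PredB _ dai (sv-dead j I₀) (snoc≢[] (chronO j) _) refl (subst (λ q → Play baseP PredB (q ∷ʳ dai)) (projects-dead j I₀) pp))))
  daimon-outcome n u is (inj₁ pp) | inj₁ (st , ok , refl) with root? st
  ... | inj₁ refl with alt-head (proj₁ (proj₁ pp))
  ...   | ()
  daimon-outcome n u is (inj₁ pp) | inj₁ (st , ok , refl) | inj₂ ne
    with PredB-snoc (chronOf st) dai (view-PredB (chronOf st) dai (sv-chron st ne) (chron≢[] st ne) refl
           (subst (λ q → Play baseP PredB (q ∷ʳ dai)) (proj₁ (projects-admissible n st ok)) pp))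
  ... | st'' , ne'' , w , k with dai-only-at-ZX st'' ne'' k
  ... | refl , xd with chron-inj st Z w
  ... | refl = proj₂ (proj₂ (projects-admissible n Z ok)) , ok , xd

  IntegerOutput : ℕ → Set
  IntegerOutput n = 1 ≤ n ⊎ zeroAnswer ≡ act pos α []

  nf⊆ : ∀ n → IntegerOutput n → ∀ c' → NF (predNetB n) baseOut c' → natD α (n ∸ 1) c'
  nf⊆ n hy c' (r , ne , inj₁ (u , is , (w , κ , eq , pk) , vw)) with positive-outcome n u is w κ eq pk (c' ++ r) vw
  ... | (r' , h) , _ = ne , r ++ r' , trans (sym (LP.++-assoc c' r r')) h
  nf⊆ n hy c' (r , ne , inj₂ (u , is , any , vw)) with daimon-outcome n u is any | hy
  ... | _ , refl , xd | inj₁ ()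
  ... | _ , refl , xd | inj₂ xa with trans (sym xd) xa
  ...   | ()

  nf⊇ : ∀ n → IntegerOutput n → ∀ c' → natD α (n ∸ 1) c' → NF (predNetB n) baseOut c'
  nf⊇ (suc j) hy c' (ne , r , h) =
    r , ne , inj₁ (moves (chronOf (FN j)) ,
      intseq-full (suc j) (FN j) PRF (gnd (proj₁ (goodView-FN j))) (playP-st (FN j) (λ ()))
        (playN-full σ (suc j) [] [] {suc j} [] (trans (LP.++-identityʳ _) (sym (natChron-full σ (suc j))))) ,
      (natPrefix α j , act pos ⟦ al j ⟧ [] , proj₂ (proj₂ PRF) , refl) ,
      subst (View baseOut (proj baseOut (moves (chronOf (FN j))))) (sym (trans h (natChron-full α j)))
        (subst (λ q → View baseOut q (outputPart (FN j))) (sym (proj₂ (proj₂ PRF))) (view-self (sv-natPrefix⁺ α j []))))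
    where PRF = projects (FN j) (λ ())
  nf⊇ zero (inj₁ ()) c' _
  nf⊇ zero (inj₂ xa) c' (ne , r , h) =
    r , ne , inj₁ (moves (chronOf ZX) ,
      intseq-full 0 ZX PRZ ndz (playP-st ZX (λ ())) (playN-full σ 0 [] [] {0} [] refl) ,
      ([] , act pos α [] , proj₂ (proj₂ PRZ) , refl) ,
      subst (View baseOut (proj baseOut (moves (chronOf ZX)))) (sym h)
        (subst (λ q → View baseOut q (act pos α [] ∷ [])) (sym (proj₂ (proj₂ PRZ))) (view-self (sv-natPrefix⁺ α 0 []))))
    where
    PRZ = projects-ZX xa
    ndz : NoDai (chronOf ZX)
    ndz = (λ ()) ∷ subst (λ x → x ≢ dai) (sym xa) (λ ()) ∷ []

  nf-nat : ∀ n → IntegerOutput n → NF (predNetB n) baseOut ≐ natD α (n ∸ 1)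
  nf-nat n hy c' = nf⊆ n hy c' , nf⊇ n hy c'

  singleton-prefix : ∀ (c' r : List Action) x → c' ≢ [] → c' ++ r ≡ x ∷ [] → c' ≡ x ∷ []
  singleton-prefix [] r x ne h = ⊥-elim (ne refl)
  singleton-prefix (y ∷ c') r x ne h with LP.∷-injective h
  ... | refl , h' = cong (y ∷_) (LP.++-conicalˡ c' r h')

  nf-dai : zeroAnswer ≡ dai → NF (predNetB 0) baseOut ≐ daiD
  nf-dai xd c' = to , from
    where
    to : NF (predNetB 0) baseOut c' → daiD c'
    to (r , ne , inj₁ (u , is , (w , κ , eq , pk) , vw)) with positive-outcome 0 u is w κ eq pk (c' ++ r) vw
    ... | _ , inj₁ ()
    ... | _ , inj₂ xa with trans (sym xd) xa
    ...   | ()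
    to (r , ne , inj₂ (u , is , any , vw)) with daimon-outcome 0 u is any
    ... | e0 , _ , _ = singleton-prefix c' r dai ne
          (view-unique (subst (λ q → View baseOut (q ∷ʳ dai) (c' ++ r)) e0 vw) (svPos refl (inj₁ refl) sv[]) [])
    from : daiD c' → NF (predNetB 0) baseOut c'
    from refl = [] , (λ ()) , inj₂ (moves (chronOf Z) ,
      intseq-full 0 Z (projects Z (λ ())) (gnd (proj₁ goodView-Z)) (playP-st Z (λ ())) (playN-full σ 0 [] [] {0} [] refl) ,
      inj₁ (subst (λ q → Play baseP PredB (q ∷ʳ dai)) (sym (proj₁ (projects Z (λ ())))) (subst (λ x → Play baseP PredB (act neg σ [] ∷ x ∷ [])) xd (playP-st ZX (λ ())))) ,
      subst (λ q → View baseOut (q ∷ʳ dai) (dai ∷ [])) (sym (proj₂ (proj₂ (projects Z (λ ()))))) (vpos refl v[]))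

  fullNode : ℕ → Node
  fullNode zero = ZX
  fullNode (suc j) = FN j

  -- An interaction whose output view contains the whole chronicle of n − 1 is the full
  -- interaction of P with n (at O j the output is a strict prefix of n − 1 only).
  full-interaction : ∀ n u → IntSeq (predNetB n) u → ∀ w κ → proj baseOut u ≡ w ∷ʳ κ → polA κ ≡ pos → ∀ r →
    View baseOut (proj baseOut u) (natChron α (n ∸ 1) ++ r) → u ≡ moves (chronOf (fullNode n))
  full-interaction n u is w κ eq pk r vw with positive-output-node n u is w κ eq pk
  ... | st , out , ok , e = trans e (pinned out ok (output-view n u st ok e vw))
    where
    pinned : ∀ {st} → OutputNode st → Admissible n st → View baseOut (outputPart st) (natChron α (n ∸ 1) ++ r) →
      moves (chronOf st) ≡ moves (chronOf (fullNode n))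
    pinned ZX-out (refl , _) _ = refl
    pinned (FN-out j) refl _ = refl
    pinned (O-out j) ok vw' with view-unique vw' (sv-natPrefix⁺ α j (0 ∷ [])) (guniq (good-natPrefix⁺ α j (0 ∷ []) ram0))
    ... | e2 with lt-split ok
    ... | m , refl with LP.++-cancelˡ (natPrefix α j) _ _ (trans (sym (LP.++-assoc (natPrefix α j) (natChron (bar j α) (suc m)) r))
            (trans (cong (_++ r) (trans (sym (natChron-split α j (suc m))) (cong (natChron α) (NP.+-suc j m)))) e2))
    ... | ()

module Theorem (σ α : Locus) (dis : Disjoint σ α) where
  open Sequences

  open Loci σ α dis
  module TreeD = PredTree σ α dis false
  module TreeN = PredTree σ α dis true
  module InterD = Interaction σ α dis false
  module InterN = Interaction σ α dis true
  module NFD = NormalForm σ α dis false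
  module NFN = NormalForm σ α dis true

  PredNat : DSet
  PredNat = TreeN.PredB

  data NetLe : Net → Net → Set₁ where
    []  : NetLe [] []
    _∷_ : ∀ {B D D' R R'} → D ⊆ᴰ D' → NetLe R R' → NetLe ((B , D) ∷ R) ((B , D') ∷ R')

  play-mono : ∀ {B D D'} s → D ⊆ᴰ D' → Play B D s → Play B D' s
  play-mono s sub (L , h) = L , λ w κ r e pk v vw → sub v (h w κ r e pk v vw)

  anyB : ∀ {R R'} → NetLe R R' → ∀ {P : Base → Set} → AnyN R (λ d → P (proj₁ d)) → AnyN R' (λ d → P (proj₁ d))
  anyB [] ()
  anyB (s ∷ le) (inj₁ x) = inj₁ x
  anyB (s ∷ le) (inj₂ x) = inj₂ (anyB le x)

  anyP : ∀ {R R'} → NetLe R R' → ∀ {f : Base → List Action} →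
    AnyN R (λ d → Play (proj₁ d) (proj₂ d) (f (proj₁ d))) → AnyN R' (λ d → Play (proj₁ d) (proj₂ d) (f (proj₁ d)))
  anyP [] ()
  anyP (s ∷ le) (inj₁ x) = inj₁ (play-mono _ s x)
  anyP (s ∷ le) (inj₂ x) = inj₂ (anyP le x)

  allP : ∀ {R R'} → NetLe R R' → ∀ {f : Base → List Action} →
    AllN R (λ d → Play (proj₁ d) (proj₂ d) (f (proj₁ d))) → AllN R' (λ d → Play (proj₁ d) (proj₂ d) (f (proj₁ d)))
  allP [] tt = tt
  allP (s ∷ le) (x , xs) = play-mono _ s x , allP le xs

  intseq-mono : ∀ {R R'} → NetLe R R' → ∀ u → IntSeq R u → IntSeq R' u
  intseq-mono le u (hs , ps) = All.map (anyB le) hs , allP le ps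

  nf-mono : ∀ {R R'} → NetLe R R' → ∀ B → NF R B ⊆ᴰ NF R' B
  nf-mono le B c (r , ne , inj₁ (u , is , x , vw)) = r , ne , inj₁ (u , intseq-mono le u is , x , vw)
  nf-mono le B c (r , ne , inj₂ (u , is , any , vw)) = r , ne , inj₂ (u , intseq-mono le u is , anyP le any , vw)

  ⊆refl : ∀ {D : DSet} → D ⊆ᴰ D
  ⊆refl c x = x

  natD∈Nat : ∀ ξ n → InNat ξ (natD ξ n)
  natD∈Nat ξ n = n , λ c → (λ x → x) , (λ x → x)

  natChron-inj : ∀ ξ m j r → natChron ξ m ++ r ≡ natChron ξ j → m ≡ j
  natChron-inj ξ zero zero r h = refl
  natChron-inj ξ zero (suc j) r ()
  natChron-inj ξ (suc m) zero r ()
  natChron-inj ξ (suc m) (suc j) r h with LP.∷-injective h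
  ... | _ , h' with LP.∷-injective h'
  ... | _ , h'' = cong suc (natChron-inj _ m j r h'')

  natChron≢[] : ∀ ξ m → natChron ξ m ≢ []
  natChron≢[] ξ zero ()
  natChron≢[] ξ (suc m) ()

  nf-zero : NF (predNet σ α 0) ⊢[ α ] ≐ daiD
  nf-zero = NFD.nf-dai refl

  nf-predecessor : (n : ℕ) → 1 ≤ n → NF (predNet σ α n) ⊢[ α ] ≐ natD α (n ∸ 1)
  nf-predecessor n h = NFD.nf-nat n (inj₁ h)

  -- P is not in Nat ⇒ Nat: on input 0 its output {✠} is not an integer.
  Pred∉Nat⇒Nat : ¬ NatImp σ α (Pred σ α)
  Pred∉Nat⇒Nat (_ , imp , _) with imp (natD σ 0) (natD∈Nat σ 0)
  ... | m , eqv with proj₁ (eqv (dai ∷ [])) (proj₂ (nf-zero (dai ∷ [])) refl)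
  ... | _ , r , h = dai∉ m h
    where
    dai∉ : ∀ m → dai ∷ r ≢ natChron α m
    dai∉ zero ()
    dai∉ (suc m) ()

  PredNat-imp : ImpProp σ α PredNat
  PredNat-imp A (n , eqA) = n ∸ 1 , λ c →
    (λ x → proj₁ (NFN.nf-nat n (inj₂ refl) c) (nf-mono (⊆refl ∷ ((λ c' → proj₁ (eqA c')) ∷ [])) baseOut c x)) ,
    (λ x → nf-mono (⊆refl ∷ ((λ c' → proj₂ (eqA c')) ∷ [])) baseOut c (proj₂ (NFN.nf-nat n (inj₂ refl) c) x))

  inputNet : DSet → ℕ → Net
  inputNet D n = (baseP , D) ∷ (baseIn , natD σ n) ∷ []

  -- A subdesign D' of P' which still maps integers to integers outputs exactly n − 1 on n,
  -- since its normal form is included in that of P'.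
  sub-output : ∀ D' → ImpProp σ α D' → D' ⊆ᴰ PredNat → ∀ n →
    NF (inputNet D' n) baseOut (natChron α (n ∸ 1))
  sub-output D' imp sub n with imp (natD σ n) (natD∈Nat σ n)
  ... | m , eqv = proj₂ (eqv _) (subst (λ q → natD α m (natChron α q)) m≡n-1 full-m)
    where
    full-m : natD α m (natChron α m)
    full-m = natChron≢[] α m , [] , LP.++-identityʳ _
    in-PredNat : natD α (n ∸ 1) (natChron α m)
    in-PredNat = proj₁ (NFN.nf-nat n (inj₂ refl) (natChron α m))
                   (nf-mono (sub ∷ (⊆refl ∷ [])) baseOut _ (proj₂ (eqv _) full-m))
    m≡n-1 : m ≡ n ∸ 1
    m≡n-1 = natChron-inj α m (n ∸ 1) (proj₁ (proj₂ in-PredNat)) (proj₂ (proj₂ in-PredNat))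

  fullNode≢root : ∀ n → NFN.fullNode n ≢ TreeN.root
  fullNode≢root zero ()
  fullNode≢root (suc _) ()

  fullNode-pos : ∀ n → polA (TreeN.lastAct (NFN.fullNode n)) ≡ pos
  fullNode-pos zero = refl
  fullNode-pos (suc j) = refl

  projects-fullNode : ∀ n → InterN.Projects (NFN.fullNode n)
  projects-fullNode zero = InterN.projects-ZX refl
  projects-fullNode (suc j) = InterN.projects (TreeN.FN j) (λ ())

  -- If a subdesign D' of P' outputs all of n − 1 on input n, the interaction went through the
  -- maximal chronicle of P' reached on input n, so this chronicle belongs to D'.
  fullNode∈sub : ∀ D' → D' ⊆ᴰ PredNat → ∀ n →
    NF (inputNet D' n) baseOut (natChron α (n ∸ 1)) → D' (TreeN.chronOf (NFN.fullNode n))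
  fullNode∈sub D' sub n (r , ne , inj₂ (u , is , any , vw))
    with NFN.daimon-outcome n u (intseq-mono le u is) (anyP le {f = λ B → proj B u ∷ʳ dai} any)
    where le = sub ∷ (⊆refl ∷ [])
  ... | _ , _ , ()
  fullNode∈sub D' sub n (r , ne , inj₁ (u , is , (w , κ , eq , pk) , vw))
    with NFN.full-interaction n u (intseq-mono (sub ∷ (⊆refl ∷ [])) u is) w κ eq pk r vw
  ... | refl = proj₂ pp (TreeN.chronOf (TreeN.parent F)) (TreeN.lastAct F) []
                 (trans (TreeN.chron-parent F neF) (sym (LP.++-identityʳ _))) (fullNode-pos n) _
                 (subst (λ q → View baseP q (TreeN.chronOf F)) (TreeN.chron-parent F neF) (view-self (TreeN.sv-chron F neF)))
    where
    F = NFN.fullNode n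
    neF : F ≢ TreeN.root
    neF = fullNode≢root n
    pp : Play baseP D' (TreeN.chronOf F)
    pp = subst (Play baseP D') (proj₁ (projects-fullNode n)) (proj₁ (proj₂ is))

  -- Minimality of P': its maximal chronicles are the full chronicles for inputs 0 and k + 1.
  PredNat-minimal : ∀ D' → Design baseP D' → ImpProp σ α D' → D' ⊆ᴰ PredNat → PredNat ⊆ᴰ D'
  PredNat-minimal D' des imp sub c (inj₁ (ne , r , h)) =
    Design.arbor des c r ne (subst D' (sym h) (fullNode∈sub D' sub 0 (sub-output D' imp sub 0)))
  PredNat-minimal D' des imp sub c (inj₂ (k , ne , r , h)) =
    Design.arbor des c r ne (subst D' (sym (trans h (TreeN.pEnd≡ k)))
      (fullNode∈sub D' sub (suc k) (sub-output D' imp sub (suc k))))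

  PredNat∈Nat⇒Nat : NatImp σ α PredNat
  PredNat∈Nat⇒Nat = TreeN.PredB-design , PredNat-imp , PredNat-minimal

  proj-empty : ∀ u → proj ⊢∅ u ≡ []
  proj-empty [] = refl
  proj-empty ((ζ , I) ∷ u) = proj-empty u

  α⊢→P : ∀ ζ {q} → locPol [ α ]⊢ ζ ≡ just q → ∃[ p ] (locPol baseP ζ ≡ just p)
  α⊢→P ζ {q} e = go (stripPrefix α ζ) refl
    where
    go : ∀ mw → stripPrefix α ζ ≡ mw → ∃[ p ] (locPol baseP ζ ≡ just p)
    go (just w) eq = _ , subst (λ z → locPol baseP z ≡ just (parity (length w) pos)) (strip-just α ζ eq) (polP-α w)
    go nothing eq with subst (λ m → firstJust (maybe (λ w → just (parity (length w) neg)) nothing m ∷ []) ≡ just q) eq e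
    ... | ()

  locPol-P-closed : ∀ {D A B} ζ → AnyN (closedNet σ α D A B) (λ d → TT (is-just (locPol (proj₁ d) ζ))) →
    ∃[ p ] (locPol baseP ζ ≡ just p)
  locPol-P-closed ζ (inj₁ h) = InterD.isJust-witness _ h
  locPol-P-closed ζ (inj₂ (inj₁ h)) with InterD.isJust-witness _ h
  ... | q , e = flip q , in→P ζ e
  locPol-P-closed ζ (inj₂ (inj₂ (inj₁ h))) with InterD.isJust-witness _ h
  ... | q , e = α⊢→P ζ e
  locPol-P-closed ζ (inj₂ (inj₂ (inj₂ ())))

  play[] : ∀ {B D} → Play B D []
  play[] = good→legal good[] , λ w κ r e → ⊥-elim (++∷≢[] w κ r (sym (trans e (LP.++-assoc w [ κ ] r))))

  EndsWithDai : DSet → DSet → DSet → List Move → Set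
  EndsWithDai D A B u = AnyN (closedNet σ α D A B) (λ d → Play (proj₁ d) (proj₂ d) (proj (proj₁ d) u ∷ʳ dai))

  first-move : ∀ {D A B} ζ I u → IntSeq (closedNet σ α D A B) ((ζ , I) ∷ u) →
    ζ ≡ σ × proj baseP ((ζ , I) ∷ u) ≡ act neg ζ I ∷ proj baseP u
  first-move {D} {A} {B} ζ I u (h ∷ _ , pP , _) with locPol-P-closed {D} {A} {B} ζ h
  ... | p , lp with trans (proj-++ baseP [ (ζ , I) ] u) (cong (_++ proj baseP u) (InterD.proj1 baseP ζ I lp))
  ... | hp with alt-head (proj₁ (proj₁ (subst (Play baseP D) hp pP)))
  ... | refl with proj₁ (proj₂ (proj₂ (proj₁ (subst (Play baseP D) hp pP)))) [] neg ζ I (proj baseP u) refl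
  ... | inj₂ (_ , _ , _ , () , _)
  ... | inj₁ refl = refl , hp

  PredNat→Pred : ∀ v → act neg σ [] ∉ v → PredNat v → Pred σ α v
  PredNat→Pred [] n (inj₁ (ne , _)) = ⊥-elim (ne refl)
  PredNat→Pred (x ∷ v) n (inj₁ (ne , r , h)) with LP.∷-injective h
  ... | refl , _ = ⊥-elim (n (here refl))
  PredNat→Pred v n (inj₂ y) = inj₂ y

  play-PredNat→Pred : ∀ s → act neg σ [] ∉ s → Play baseP PredNat s → Play baseP (Pred σ α) s
  play-PredNat→Pred s n (L , h) = L , λ w κ r e pk v vw →
    PredNat→Pred v (λ m → n (subst (_ ∈_) (sym e) (∈-++⁺ˡ (view-sub vw m)))) (h w κ r e pk v vw)

  dai-after-σ∅ : ∀ A B u → IntSeq (closedNet σ α PredNat A B) ((σ , []) ∷ u) →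
    IntSeq (closedNet σ α (Pred σ α) A B) [ (σ , []) ] × EndsWithDai (Pred σ α) A B [ (σ , []) ]
  dai-after-σ∅ A B u is with intseq-prefix (closedNet σ α PredNat A B) [ (σ , []) ] u is
  ... | hs , _ , pA , pB , _ =
    (hs , subst (Play baseP (Pred σ α)) prσ (NFD.playP-st TreeD.Z (λ ())) , pA , pB , tt) ,
    inj₁ (subst (λ q → Play baseP (Pred σ α) (q ∷ʳ dai)) prσ (NFD.playP-st TreeD.ZX (λ ())))
    where
    prσ = sym (InterD.proj1 baseP σ [] (polP (sg 0)))

  -- If σ is opened with a nonempty ramification, P's chronicle never meets (−,σ,∅) (σ cannot be
  -- opened twice), so a converging interaction of P' is also one of P.
  converge-avoiding : ∀ A B I u → I ≢ [] → IntSeq (closedNet σ α PredNat A B) ((σ , I) ∷ u) →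
    EndsWithDai PredNat A B ((σ , I) ∷ u) →
    IntSeq (closedNet σ α (Pred σ α) A B) ((σ , I) ∷ u) × EndsWithDai (Pred σ α) A B ((σ , I) ∷ u)
  converge-avoiding A B I u I≢ is@(hs , pP , pA , pB , _) any with first-move σ I u is
  ... | _ , hp =
    (hs , subst (Play baseP (Pred σ α)) (sym hp) (play-PredNat→Pred _ avoid pP') , pA , pB , tt) ,
    converge any
    where
    pP' : Play baseP PredNat (act neg σ I ∷ proj baseP u)
    pP' = subst (Play baseP PredNat) hp pP
    avoid : act neg σ [] ∉ (act neg σ I ∷ proj baseP u)
    avoid (here refl) = I≢ refl
    avoid (there m) with proj₁ (proj₂ (proj₂ (proj₂ (proj₁ pP'))))
    ... | σ-fresh ∷ _ = All.lookup σ-fresh (foci-∈ m) refl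
    avoid-dai : act neg σ [] ∉ (proj baseP ((σ , I) ∷ u) ∷ʳ dai)
    avoid-dai m with ∈-++⁻ (proj baseP ((σ , I) ∷ u)) m
    ... | inj₁ m' = avoid (subst (_ ∈_) hp m')
    ... | inj₂ (here ())
    ... | inj₂ (there ())
    converge : EndsWithDai PredNat A B ((σ , I) ∷ u) → EndsWithDai (Pred σ α) A B ((σ , I) ∷ u)
    converge (inj₁ pp) = inj₁ (play-PredNat→Pred _ avoid-dai pp)
    converge (inj₂ x) = inj₂ x

  transfer : ∀ A B u → IntSeq (closedNet σ α PredNat A B) u → EndsWithDai PredNat A B u →
    ∃[ u' ] (IntSeq (closedNet σ α (Pred σ α) A B) u' × EndsWithDai (Pred σ α) A B u')
  transfer A B [] _ (inj₁ pp) with alt-head (proj₁ (proj₁ pp))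
  ... | ()
  transfer A B [] (hs , pP , pA , pB , tt) (inj₂ x) = [] , ([] , play[] , pA , pB , tt) , inj₂ x
  transfer A B ((ζ , I) ∷ u) is any with first-move ζ I u is
  ... | refl , _ with LP.≡-dec NP._≟_ I []
  ... | yes refl = [ (σ , []) ] , dai-after-σ∅ A B u is
  ... | no I≢ = (σ , I) ∷ u , converge-avoiding A B I u I≢ is any

  closedNF⊆dai : ∀ A B c → NF (closedNet σ α (Pred σ α) A B) ⊢∅ c → daiD c
  closedNF⊆dai A B c (r , ne , inj₁ (u , _ , (w , κ , eq , _) , _)) = ⊥-elim (snoc≢[] w κ (trans (sym eq) (proj-empty u)))
  closedNF⊆dai A B c (r , ne , inj₂ (u , _ , _ , vw)) =
    NFD.singleton-prefix c r dai ne (view-unique (subst (λ q → View ⊢∅ (q ∷ʳ dai) (c ++ r)) (proj-empty u) vw) (svPos refl (inj₁ refl) sv[]) [])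

  -- Orthogonality to P' ∈ Nat ⇒ Nat makes the interaction with P converge.
  closedNF⊇dai : ∀ A B → Orth σ α (NatImp σ α) A B → ∀ c → daiD c → NF (closedNet σ α (Pred σ α) A B) ⊢∅ c
  closedNF⊇dai A B (_ , _ , orth) .(dai ∷ []) refl with proj₂ (orth PredNat PredNat∈Nat⇒Nat (dai ∷ [])) refl
  ... | r , ne , inj₁ (u , _ , (w , κ , eq , _) , _) = ⊥-elim (snoc≢[] w κ (trans (sym eq) (proj-empty u)))
  ... | r , ne , inj₂ (u , is , any , vw) with transfer A B u is any
  ... | u' , is' , any' = [] , (λ ()) , inj₂ (u' , is' , any' ,
          subst (λ q → View ⊢∅ (q ∷ʳ dai) (dai ∷ [])) (sym (proj-empty u')) (vpos refl v[]))

  Pred∈Nat⇒Nat⊥⊥ : BiOrth σ α (NatImp σ α) (Pred σ α)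
  Pred∈Nat⇒Nat⊥⊥ = TreeD.PredB-design , λ A B o c → closedNF⊆dai A B c , closedNF⊇dai A B o c

mainTheorem4 : (σ α : Locus) → Disjoint σ α →
    (NF (predNet σ α 0) ⊢[ α ] ≐ daiD)
    × BiOrth σ α (NatImp σ α) (Pred σ α)
    × ¬ NatImp σ α (Pred σ α)
    × ((n : ℕ) → 1 ≤ n → NF (predNet σ α n) ⊢[ α ] ≐ natD α (n ∸ 1))
mainTheorem4 σ α dis = nf-zero , Pred∈Nat⇒Nat⊥⊥ , Pred∉Nat⇒Nat , nf-predecessor
  where open Theorem σ α dis
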